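{- There is no polynomial $p$ with the following property: for every finite set $E$ with $|E|=n$ and every connectivity function $\lambda:2^E\to\mathbb R$ that is not the connectivity function of any matroid on $E$, there is a family $\mathcal A$ of at most $p(n)$ subsets of $E$ such that no connectivity function on $E$ agreeing with $\lambda$ on all members of $\mathcal A$ is the connectivity function of a matroid on $E$. In particular, the fact that a connectivity function on an $n$-element set is not the connectivity function of a matroid cannot in general be established using a number of evaluations of the connectivity function bounded by a polynomial in $n$.
   Context: A connectivity function on a finite set $E$ is a function $\lambda:2^E\to\mathbb R$ with $\lambda(\emptyset)=0$, $\lambda(X)=\lambda(E-X)$ for all $X\subseteq E$, and $\lambda(X\cap Y)+\lambda(X\cup Y)\le\lambda(X)+\lambda(Y)$ for all $X,Y\subseteq E$. The connectivity function of a matroid $M$ on $E$ with rank function $r$ is $\mu_M(X)=r(X)+r(E-X)-r(E)$. -}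

module Defs where

open import Data.Nat as ℕ using (ℕ; zero; suc)
open import Data.List using (List; []; _∷_)
open import Data.Fin.Subset using (Subset; ⊥; ⊤; ∁; _∩_; _∪_; _⊆_; ∣_∣)
open import Data.Rational as ℚ using (ℚ; 0ℚ; _+_; _-_; _≤_)
open import Data.Product using (Σ)
open import Data.Integer using (+_)
open import Relation.Binary.PropositionalEquality using (_≡_)

-- Polynomials with natural-number coefficients, as coefficient lists
-- (constant term first).
Poly : Set
Poly = List ℕ

eval : Poly → ℕ → ℕ
eval []       x = 0
eval (c ∷ cs) x = c ℕ.+ x ℕ.* eval cs x

record IsConnectivityFunction {n : ℕ} (f : Subset n → ℚ) : Set where
  field
    empty     : f ⊥ ≡ 0ℚ
    symmetric : ∀ X → f X ≡ f (∁ X)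
    submod    : ∀ X Y → f (X ∩ Y) + f (X ∪ Y) ≤ f X + f Y

record Matroid (n : ℕ) : Set where
  field
    rank      : Subset n → ℕ
    bounded   : ∀ X → rank X ℕ.≤ ∣ X ∣
    monotone  : ∀ X Y → X ⊆ Y → rank X ℕ.≤ rank Y
    submod    : ∀ X Y → rank (X ∩ Y) ℕ.+ rank (X ∪ Y) ℕ.≤ rank X ℕ.+ rank Y

ℕ→ℚ : ℕ → ℚ
ℕ→ℚ k = (+ k) ℚ./ 1

μ : {n : ℕ} → Matroid n → Subset n → ℚ
μ M X = (ℕ→ℚ (rank X) + ℕ→ℚ (rank (∁ X))) - ℕ→ℚ (rank ⊤)
  where open Matroid M

IsMatroidConnectivity : {n : ℕ} → (Subset n → ℚ) → Set
IsMatroidConnectivity {n} f = Σ (Matroid n) (λ M → ∀ X → f X ≡ μ M X)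

-- Let r = 3 + 2J and n = 2r. An induced path of length at least 2 ^ J in the grid {0, 1, 2}ᴶ, closed up
-- through a triangle, is encoded as an odd cycle X 0, …, X (N - 1) of r-subsets of an n-set E in which
-- X i and X k share r - 1 elements exactly when i and k are neighbours, and always at least 2.  Lowering
-- the rank of every X i in the uniform matroid of rank r gives a set function whose connectivity
-- function λ is not matroidal: a matroid realising λ must give exactly one set of each pair
-- {X i, E - X i} rank r - 1, and adjacent pairs must choose differently, which an odd cycle forbids.
-- Deleting a vertex v leaves a path; lowering X i or E - X i according to a 2-colouring of that path
-- yields a sparse paving matroid whose connectivity function agrees with λ off X v and E - X v.  Hence
-- λ is a connectivity function (four sets always miss some pair), and fewer than N evaluations never
-- certify non-matroidality, while N ≥ 2 ^ J and n is linear in J.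

module Submission where

import Algebra.Lattice.Properties.BooleanAlgebra as BooleanAlgebraProperties
import Algebra.Properties.CommutativeSemigroup as CommutativeSemigroupProperties
open import Data.Bool using (Bool; true; false; not; if_then_else_; _xor_; T)
open import Data.Bool.Properties
  using (¬-not; not-¬; not-involutive; not-injective; not-distribˡ-xor; not-distribʳ-xor; xor-identityʳ)
open import Data.Empty using (⊥-elim) renaming (⊥ to Empty)
open import Data.Fin using (Fin; toℕ; fromℕ<)
open import Data.Fin.Properties using (toℕ<n; toℕ-fromℕ<; toℕ-injective; injective⇒≤; ¬∀⟶∃¬) renaming (any? to anyFin?)
open import Data.Fin.Subset using (Subset; ⊥; ⊤; ∁; _∩_; _∪_; _⊆_; ∣_∣)
open import Data.Fin.Subset.Properties
  using (∪-∩-booleanAlgebra; ∩-comm; ∪-comm; ∩-idem; ∩-inverseʳ; drop-∷-⊆; p⊆q⇒∣p∣≤∣q∣; ∣p∣≤n; ∣∁p∣≡n∸∣p∣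
        ; ∣⊥∣≡0; ∣⊤∣≡n; ⊆⊤; p∩q⊆p; p⊆p∪q; ∣p∩q∣≤∣p∣; ∣p∩q∣≤∣q∣)
open import Data.List using (List; []; _∷_; _++_; map; length; lookup)
open import Data.List.Properties using (++-identityʳ; length-++; length-map)
open import Data.List.Relation.Unary.All as All using (All; []; _∷_)
open import Data.List.Relation.Unary.All.Properties using (++⁺; map⁺; ¬Any⇒All¬)
open import Data.List.Relation.Unary.Any as Any using (Any; any?)
open import Data.List.Relation.Unary.Any.Properties using (lookup-index)
open import Data.Nat as ℕ using (ℕ; zero; suc; _+_; _*_; _^_; _∸_; _⊓_; _≤_; _<_; z≤n; s≤s; z<s)
open import Data.Nat.Properties
open import Data.Nat.Tactic.RingSolver using (solve-∀)
open import Data.Product using (Σ; ∃; _×_; _,_; proj₁; proj₂)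
open import Data.Rational as ℚ using (ℚ; 0ℚ)
import Data.Rational.Properties as ℚₚ
open import Data.Rational.Solver using (module +-*-Solver)
open import Data.Sum using (_⊎_; inj₁; inj₂)
open import Data.Unit using (tt) renaming (⊤ to Unit)
open import Data.Vec using (Vec; []; _∷_; here; replicate) renaming (_++_ to _++ᵛ_)
open import Data.Vec.Properties using (≡-dec; ++-injectiveˡ)
open import Function using (_∘_)
open import Relation.Binary using (tri<; tri≈; tri>)
open import Relation.Binary.PropositionalEquality hiding (J)
open import Relation.Nullary using (¬_; Dec; yes; no; does)
open import Relation.Nullary.Decidable using (dec-true; dec-false; _⊎-dec_)

open import Defs

open CommutativeSemigroupProperties +-commutativeSemigroup using (interchange)

module SubsetBooleanAlgebra {n : ℕ} = BooleanAlgebraProperties (∪-∩-booleanAlgebra n)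
open SubsetBooleanAlgebra using ()
  renaming (¬-involutive to ∁-involutive; deMorgan₁ to ∁-∩; deMorgan₂ to ∁-∪; ¬⊥≈⊤ to ∁⊥≡⊤)

∁-injective : ∀ {n} {p q : Subset n} → ∁ p ≡ ∁ q → p ≡ q
∁-injective {p = p} {q} e = trans (sym (∁-involutive p)) (trans (cong ∁ e) (∁-involutive q))

∣p++q∣≡∣p∣+∣q∣ : ∀ {m k} (p : Subset m) (q : Subset k) → ∣ p ++ᵛ q ∣ ≡ ∣ p ∣ + ∣ q ∣
∣p++q∣≡∣p∣+∣q∣ []          q = refl
∣p++q∣≡∣p∣+∣q∣ (true ∷ p)  q = cong suc (∣p++q∣≡∣p∣+∣q∣ p q)
∣p++q∣≡∣p∣+∣q∣ (false ∷ p) q = ∣p++q∣≡∣p∣+∣q∣ p q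

∩-++ : ∀ {m k} (p p′ : Subset m) (q q′ : Subset k) → (p ++ᵛ q) ∩ (p′ ++ᵛ q′) ≡ (p ∩ p′) ++ᵛ (q ∩ q′)
∩-++ []      []       q q′ = refl
∩-++ (x ∷ p) (y ∷ p′) q q′ = cong (_ ∷_) (∩-++ p p′ q q′)

∁-++ : ∀ {m k} (p : Subset m) (q : Subset k) → ∁ (p ++ᵛ q) ≡ ∁ p ++ᵛ ∁ q
∁-++ []      q = refl
∁-++ (x ∷ p) q = cong (_ ∷_) (∁-++ p q)

∣∩-++∣ : ∀ {m k} (p p′ : Subset m) (q q′ : Subset k) →
                ∣ (p ++ᵛ q) ∩ (p′ ++ᵛ q′) ∣ ≡ ∣ p ∩ p′ ∣ + ∣ q ∩ q′ ∣
∣∩-++∣ p p′ q q′ = trans (cong ∣_∣ (∩-++ p p′ q q′)) (∣p++q∣≡∣p∣+∣q∣ (p ∩ p′) (q ∩ q′))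

∣p∩q∣+∣p∪q∣≡∣p∣+∣q∣ : ∀ {n} (p q : Subset n) → ∣ p ∩ q ∣ + ∣ p ∪ q ∣ ≡ ∣ p ∣ + ∣ q ∣
∣p∩q∣+∣p∪q∣≡∣p∣+∣q∣ []          []          = refl
∣p∩q∣+∣p∪q∣≡∣p∣+∣q∣ (true ∷ p)  (true ∷ q)  =
  cong suc (trans (+-suc _ _) (trans (cong suc (∣p∩q∣+∣p∪q∣≡∣p∣+∣q∣ p q)) (sym (+-suc _ _))))
∣p∩q∣+∣p∪q∣≡∣p∣+∣q∣ (true ∷ p)  (false ∷ q) = trans (+-suc _ _) (cong suc (∣p∩q∣+∣p∪q∣≡∣p∣+∣q∣ p q))
∣p∩q∣+∣p∪q∣≡∣p∣+∣q∣ (false ∷ p) (true ∷ q)  =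
  trans (+-suc _ _) (trans (cong suc (∣p∩q∣+∣p∪q∣≡∣p∣+∣q∣ p q)) (sym (+-suc _ _)))
∣p∩q∣+∣p∪q∣≡∣p∣+∣q∣ (false ∷ p) (false ∷ q) = ∣p∩q∣+∣p∪q∣≡∣p∣+∣q∣ p q

∣∁p∣+∣p∣≡n : ∀ {n} (p : Subset n) → ∣ ∁ p ∣ + ∣ p ∣ ≡ n
∣∁p∣+∣p∣≡n p = trans (cong (_+ ∣ p ∣) (∣∁p∣≡n∸∣p∣ p)) (m∸n+n≡m (∣p∣≤n p))

∣p∩∁q∣+∣p∩q∣≡∣p∣ : ∀ {n} (p q : Subset n) → ∣ p ∩ ∁ q ∣ + ∣ p ∩ q ∣ ≡ ∣ p ∣
∣p∩∁q∣+∣p∩q∣≡∣p∣ []          []          = refl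
∣p∩∁q∣+∣p∩q∣≡∣p∣ (true ∷ p)  (true ∷ q)  = trans (+-suc _ _) (cong suc (∣p∩∁q∣+∣p∩q∣≡∣p∣ p q))
∣p∩∁q∣+∣p∩q∣≡∣p∣ (true ∷ p)  (false ∷ q) = cong suc (∣p∩∁q∣+∣p∩q∣≡∣p∣ p q)
∣p∩∁q∣+∣p∩q∣≡∣p∣ (false ∷ p) (_ ∷ q)     = ∣p∩∁q∣+∣p∩q∣≡∣p∣ p q

p⊆q∧∣p∣≡∣q∣⇒p≡q : ∀ {n} {p q : Subset n} → p ⊆ q → ∣ p ∣ ≡ ∣ q ∣ → p ≡ q
p⊆q∧∣p∣≡∣q∣⇒p≡q {p = []}        {[]}        _ _ = refl
p⊆q∧∣p∣≡∣q∣⇒p≡q {p = true ∷ p}  {true ∷ q}  s e = cong (true ∷_) (p⊆q∧∣p∣≡∣q∣⇒p≡q (drop-∷-⊆ s) (suc-injective e))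
p⊆q∧∣p∣≡∣q∣⇒p≡q {p = true ∷ p}  {false ∷ q} s e with s here
... | ()
p⊆q∧∣p∣≡∣q∣⇒p≡q {p = false ∷ p} {true ∷ q}  s e = ⊥-elim (<-irrefl e (s≤s (p⊆q⇒∣p∣≤∣q∣ (drop-∷-⊆ s))))
p⊆q∧∣p∣≡∣q∣⇒p≡q {p = false ∷ p} {false ∷ q} s e = cong (false ∷_) (p⊆q∧∣p∣≡∣q∣⇒p≡q (drop-∷-⊆ s) e)

∣p∩q∣≡∣p∣⇒p∩q≡p : ∀ {n} (p q : Subset n) → ∣ p ∩ q ∣ ≡ ∣ p ∣ → p ∩ q ≡ p
∣p∩q∣≡∣p∣⇒p∩q≡p p q = p⊆q∧∣p∣≡∣q∣⇒p≡q (p∩q⊆p p q)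

∣p∪q∣≡∣p∣⇒p∪q≡p : ∀ {n} (p q : Subset n) → ∣ p ∪ q ∣ ≡ ∣ p ∣ → p ∪ q ≡ p
∣p∪q∣≡∣p∣⇒p∪q≡p p q e = sym (p⊆q∧∣p∣≡∣q∣⇒p≡q (p⊆p∪q q) (sym e))

∣p∩q∣≡∣p∣⇒p∪q≡q : ∀ {n} (p q : Subset n) → ∣ p ∩ q ∣ ≡ ∣ p ∣ → p ∪ q ≡ q
∣p∩q∣≡∣p∣⇒p∪q≡q p q i≡a = trans (∪-comm p q) (∣p∪q∣≡∣p∣⇒p∪q≡p q p (trans (cong ∣_∣ (∪-comm q p)) u≡b))
  where
  u≡b : ∣ p ∪ q ∣ ≡ ∣ q ∣
  u≡b = +-cancelˡ-≡ ∣ p ∣ _ _ (subst (λ i → i + ∣ p ∪ q ∣ ≡ ∣ p ∣ + ∣ q ∣) i≡a (∣p∩q∣+∣p∪q∣≡∣p∣+∣q∣ p q))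

-- Connectivity functions of ℕ-valued set functions

module _ where
  open import Data.Integer as ℤ using (+_)
  import Data.Integer.Properties as ℤₚ
  open import Data.Nat.Coprimality using (1-coprimeTo) renaming (sym to coprime-sym)
  open import Data.Rational using (mkℚ; ↥_)

  private
    ℕ→ℚ-normal : ∀ k → ℕ→ℚ k ≡ mkℚ (+ k) 0 (coprime-sym (1-coprimeTo k))
    ℕ→ℚ-normal k = ℚₚ.↥p/↧p≡p (mkℚ (+ k) 0 (coprime-sym (1-coprimeTo k)))

  ℕ→ℚ-+ : ∀ a b → ℕ→ℚ a ℚ.+ ℕ→ℚ b ≡ ℕ→ℚ (a + b)
  ℕ→ℚ-+ a b rewrite ℕ→ℚ-normal a | ℕ→ℚ-normal b =
    ℚₚ./-cong {p₁ = + a ℤ.* + 1 ℤ.+ + b ℤ.* + 1} {q₁ = 1} {p₂ = + (a + b)} {q₂ = 1}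
      (cong₂ ℤ._+_ (ℤₚ.*-identityʳ (+ a)) (ℤₚ.*-identityʳ (+ b))) refl

  ℕ→ℚ-injective : ∀ {a b} → ℕ→ℚ a ≡ ℕ→ℚ b → a ≡ b
  ℕ→ℚ-injective {a} {b} e =
    ℤₚ.+-injective (trans (cong ↥_ (sym (ℕ→ℚ-normal a))) (trans (cong ↥_ e) (cong ↥_ (ℕ→ℚ-normal b))))

  ℕ→ℚ-mono-≤ : ∀ {a b} → a ≤ b → ℕ→ℚ a ℚ.≤ ℕ→ℚ b
  ℕ→ℚ-mono-≤ {a} {b} le rewrite ℕ→ℚ-normal a | ℕ→ℚ-normal b =
    ℚ.*≤* (subst₂ ℤ._≤_ (sym (ℤₚ.*-identityʳ (+ a))) (sym (ℤₚ.*-identityʳ (+ b))) (ℤ.+≤+ le))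

connectivityValue : ℕ → ℕ → ℕ → ℚ
connectivityValue a b c = (ℕ→ℚ a ℚ.+ ℕ→ℚ b) ℚ.- ℕ→ℚ c

connectivityOf : ∀ {n} → (Subset n → ℕ) → Subset n → ℚ
connectivityOf ρ X = connectivityValue (ρ X) (ρ (∁ X)) (ρ ⊤)

module _ where
  open +-*-Solver

  private
    connectivityValue-+ : ∀ a b c c′ → connectivityValue a b c ℚ.+ (ℕ→ℚ c ℚ.+ ℕ→ℚ c′) ≡ ℕ→ℚ (a + b + c′)
    connectivityValue-+ a b c c′ = begin
      connectivityValue a b c ℚ.+ (ℕ→ℚ c ℚ.+ ℕ→ℚ c′)
        ≡⟨ solve 4 (λ a b c c′ → ((a :+ b) :- c) :+ (c :+ c′) := (a :+ b) :+ c′) refl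
             (ℕ→ℚ a) (ℕ→ℚ b) (ℕ→ℚ c) (ℕ→ℚ c′) ⟩
      (ℕ→ℚ a ℚ.+ ℕ→ℚ b) ℚ.+ ℕ→ℚ c′  ≡⟨ cong (ℚ._+ ℕ→ℚ c′) (ℕ→ℚ-+ a b) ⟩
      ℕ→ℚ (a + b) ℚ.+ ℕ→ℚ c′        ≡⟨ ℕ→ℚ-+ (a + b) c′ ⟩
      ℕ→ℚ (a + b + c′)              ∎
      where open ≡-Reasoning

    connectivityValue-double : ∀ a b a′ b′ c →
      connectivityValue a b c ℚ.+ connectivityValue a′ b′ c ≡ ℕ→ℚ (a + b + (a′ + b′)) ℚ.+ (ℚ.- ℕ→ℚ c ℚ.+ ℚ.- ℕ→ℚ c)
    connectivityValue-double a b a′ b′ c = begin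
      connectivityValue a b c ℚ.+ connectivityValue a′ b′ c
        ≡⟨ solve 5 (λ a b a′ b′ c → ((a :+ b) :- c) :+ ((a′ :+ b′) :- c) := ((a :+ b) :+ (a′ :+ b′)) :+ (:- c :+ :- c))
             refl (ℕ→ℚ a) (ℕ→ℚ b) (ℕ→ℚ a′) (ℕ→ℚ b′) (ℕ→ℚ c) ⟩
      ((ℕ→ℚ a ℚ.+ ℕ→ℚ b) ℚ.+ (ℕ→ℚ a′ ℚ.+ ℕ→ℚ b′)) ℚ.+ (ℚ.- ℕ→ℚ c ℚ.+ ℚ.- ℕ→ℚ c)
        ≡⟨ cong (ℚ._+ (ℚ.- ℕ→ℚ c ℚ.+ ℚ.- ℕ→ℚ c))
             (trans (cong₂ ℚ._+_ (ℕ→ℚ-+ a b) (ℕ→ℚ-+ a′ b′)) (ℕ→ℚ-+ (a + b) (a′ + b′))) ⟩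
      ℕ→ℚ (a + b + (a′ + b′)) ℚ.+ (ℚ.- ℕ→ℚ c ℚ.+ ℚ.- ℕ→ℚ c) ∎
      where open ≡-Reasoning

  connectivityOf-cong : ∀ {n} (ρ σ : Subset n → ℕ) X → ρ X + ρ (∁ X) ≡ σ X + σ (∁ X) → ρ ⊤ ≡ σ ⊤ →
                        connectivityOf ρ X ≡ connectivityOf σ X
  connectivityOf-cong ρ σ X pair≡ ⊤≡ = cong₂ ℚ._-_
    (trans (ℕ→ℚ-+ (ρ X) (ρ (∁ X))) (trans (cong ℕ→ℚ pair≡) (sym (ℕ→ℚ-+ (σ X) (σ (∁ X))))))
    (cong ℕ→ℚ ⊤≡)

  connectivityOf-injective : ∀ {n} (ρ σ : Subset n → ℕ) X → connectivityOf ρ X ≡ connectivityOf σ X →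
                             ρ X + ρ (∁ X) + σ ⊤ ≡ σ X + σ (∁ X) + ρ ⊤
  connectivityOf-injective ρ σ X e = ℕ→ℚ-injective (begin
    ℕ→ℚ (ρ X + ρ (∁ X) + σ ⊤)                                  ≡⟨ sym (connectivityValue-+ (ρ X) (ρ (∁ X)) (ρ ⊤) (σ ⊤)) ⟩
    connectivityOf ρ X ℚ.+ (ℕ→ℚ (ρ ⊤) ℚ.+ ℕ→ℚ (σ ⊤))          ≡⟨ cong₂ ℚ._+_ e (ℚₚ.+-comm (ℕ→ℚ (ρ ⊤)) (ℕ→ℚ (σ ⊤))) ⟩
    connectivityOf σ X ℚ.+ (ℕ→ℚ (σ ⊤) ℚ.+ ℕ→ℚ (ρ ⊤))          ≡⟨ connectivityValue-+ (σ X) (σ (∁ X)) (σ ⊤) (ρ ⊤) ⟩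
    ℕ→ℚ (σ X + σ (∁ X) + ρ ⊤)                                  ∎)
    where open ≡-Reasoning

  connectivityOf-mono : ∀ {n} (ρ : Subset n → ℕ) X Y Z W →
    ρ X + ρ (∁ X) + (ρ Y + ρ (∁ Y)) ≤ ρ Z + ρ (∁ Z) + (ρ W + ρ (∁ W)) →
    connectivityOf ρ X ℚ.+ connectivityOf ρ Y ℚ.≤ connectivityOf ρ Z ℚ.+ connectivityOf ρ W
  connectivityOf-mono ρ X Y Z W le =
    subst₂ ℚ._≤_ (sym (connectivityValue-double (ρ X) (ρ (∁ X)) (ρ Y) (ρ (∁ Y)) (ρ ⊤)))
                 (sym (connectivityValue-double (ρ Z) (ρ (∁ Z)) (ρ W) (ρ (∁ W)) (ρ ⊤)))
      (ℚₚ.+-monoˡ-≤ (ℚ.- ℕ→ℚ (ρ ⊤) ℚ.+ ℚ.- ℕ→ℚ (ρ ⊤)) (ℕ→ℚ-mono-≤ le))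

  connectivityValue-zero : ∀ b → connectivityValue 0 b b ≡ 0ℚ
  connectivityValue-zero b = trans (cong (ℚ._- ℕ→ℚ b) (ℚₚ.+-identityˡ (ℕ→ℚ b))) (ℚₚ.+-inverseʳ (ℕ→ℚ b))

  connectivityValue-comm : ∀ a b c → connectivityValue a b c ≡ connectivityValue b a c
  connectivityValue-comm a b c = cong (ℚ._- ℕ→ℚ c) (ℚₚ.+-comm (ℕ→ℚ a) (ℕ→ℚ b))

Submodular : ∀ {n} → (Subset n → ℕ) → Set
Submodular ρ = ∀ X Y → ρ (X ∩ Y) + ρ (X ∪ Y) ≤ ρ X + ρ Y

connectivityOf-isConnectivityFunction : ∀ {n} {ρ : Subset n → ℕ} → ρ ⊥ ≡ 0 → Submodular ρ →
                                        IsConnectivityFunction (connectivityOf ρ)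
connectivityOf-isConnectivityFunction {ρ = ρ} ρ⊥≡0 ρ-submodular = record
  { empty     = trans (cong₂ (λ a X → connectivityValue a (ρ X) (ρ ⊤)) ρ⊥≡0 ∁⊥≡⊤) (connectivityValue-zero (ρ ⊤))
  ; symmetric = λ X → trans (connectivityValue-comm (ρ X) (ρ (∁ X)) (ρ ⊤))
                            (cong (λ Y → connectivityValue (ρ (∁ X)) (ρ Y) (ρ ⊤)) (sym (∁-involutive X)))
  ; submod    = λ X Y → connectivityOf-mono ρ (X ∩ Y) (X ∪ Y) X Y (complemented-submodular X Y)
  }
  where
  complemented-submodular : ∀ X Y → ρ (X ∩ Y) + ρ (∁ (X ∩ Y)) + (ρ (X ∪ Y) + ρ (∁ (X ∪ Y)))
                                    ≤ ρ X + ρ (∁ X) + (ρ Y + ρ (∁ Y))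
  complemented-submodular X Y rewrite ∁-∩ X Y | ∁-∪ X Y = begin
    ρ (X ∩ Y) + ρ (∁ X ∪ ∁ Y) + (ρ (X ∪ Y) + ρ (∁ X ∩ ∁ Y))
      ≡⟨ interchange (ρ (X ∩ Y)) _ (ρ (X ∪ Y)) _ ⟩
    ρ (X ∩ Y) + ρ (X ∪ Y) + (ρ (∁ X ∪ ∁ Y) + ρ (∁ X ∩ ∁ Y))
      ≡⟨ cong (ρ (X ∩ Y) + ρ (X ∪ Y) +_) (+-comm (ρ (∁ X ∪ ∁ Y)) _) ⟩
    ρ (X ∩ Y) + ρ (X ∪ Y) + (ρ (∁ X ∩ ∁ Y) + ρ (∁ X ∪ ∁ Y))
      ≤⟨ +-mono-≤ (ρ-submodular X Y) (ρ-submodular (∁ X) (∁ Y)) ⟩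
    ρ X + ρ Y + (ρ (∁ X) + ρ (∁ Y))
      ≡⟨ interchange (ρ X) (ρ Y) (ρ (∁ X)) (ρ (∁ Y)) ⟩
    ρ X + ρ (∁ X) + (ρ Y + ρ (∁ Y)) ∎
    where open ≤-Reasoning

module _ {n} (M : Matroid n) where
  open Matroid M

  rank-⊥ : rank ⊥ ≡ 0
  rank-⊥ = n≤0⇒n≡0 (subst (rank ⊥ ≤_) (∣⊥∣≡0 n) (bounded ⊥))

  μ-isConnectivityFunction : IsConnectivityFunction (μ M)
  μ-isConnectivityFunction = connectivityOf-isConnectivityFunction {ρ = rank} rank-⊥ submod

-- Sparse paving matroids

+-≡-componentwise : ∀ {a b c d} → a + b ≡ c + d → c ≤ a → d ≤ b → c ≡ a × d ≡ b
+-≡-componentwise {a} {b} {c} {d} a+b≡c+d c≤a d≤b with m≤n⇒m<n∨m≡n c≤a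
... | inj₁ c<a  = ⊥-elim (<⇒≱ (+-mono-<-≤ c<a d≤b) (≤-reflexive a+b≡c+d))
... | inj₂ refl = refl , +-cancelˡ-≡ c d b (sym a+b≡c+d)

≤-complement : ∀ {i u a b} → i + u ≡ a + b → i ≤ b → a ≤ u
≤-complement {i} {u} {a} {b} i+u≡a+b i≤b = +-cancelʳ-≤ b a u (begin
  a + b  ≡⟨ sym i+u≡a+b ⟩
  i + u  ≤⟨ +-monoˡ-≤ u i≤b ⟩
  b + u  ≡⟨ +-comm b u ⟩
  u + b  ∎)
  where open ≤-Reasoning

⊓-concave : ∀ r {i u a b} → i + u ≡ a + b → i ≤ a → i ≤ b → i ⊓ r + u ⊓ r ≤ a ⊓ r + b ⊓ r
⊓-concave r {i} {u} {a} {b} i+u≡a+b i≤a i≤b with ≤-total r i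
... | inj₁ r≤i rewrite m≥n⇒m⊓n≡n r≤i | m≥n⇒m⊓n≡n (≤-trans r≤i i≤a) | m≥n⇒m⊓n≡n (≤-trans r≤i i≤b)
                     | m≥n⇒m⊓n≡n (≤-trans r≤i (≤-trans i≤a (≤-complement i+u≡a+b i≤b))) = ≤-refl
... | inj₂ i≤r with ≤-total u r
...   | inj₁ u≤r = ≤-reflexive (begin
  i ⊓ r + u ⊓ r  ≡⟨ cong₂ _+_ (m≤n⇒m⊓n≡m i≤r) (m≤n⇒m⊓n≡m u≤r) ⟩
  i + u          ≡⟨ i+u≡a+b ⟩
  a + b          ≡⟨ sym (cong₂ _+_ (m≤n⇒m⊓n≡m (≤-trans (≤-complement i+u≡a+b i≤b) u≤r))
                                   (m≤n⇒m⊓n≡m (≤-trans (≤-complement (trans i+u≡a+b (+-comm a b)) i≤a) u≤r))) ⟩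
  a ⊓ r + b ⊓ r  ∎)
  where open ≡-Reasoning
...   | inj₂ r≤u rewrite m≤n⇒m⊓n≡m i≤r | m≥n⇒m⊓n≡n r≤u with ≤-total r a | ≤-total r b
...     | inj₁ r≤a | _ rewrite m≥n⇒m⊓n≡n r≤a = subst (i + r ≤_) (+-comm (b ⊓ r) r) (+-monoˡ-≤ r (⊓-glb i≤b i≤r))
...     | inj₂ a≤r | inj₁ r≤b rewrite m≤n⇒m⊓n≡m a≤r | m≥n⇒m⊓n≡n r≤b = +-monoˡ-≤ r i≤a
...     | inj₂ a≤r | inj₂ b≤r rewrite m≤n⇒m⊓n≡m a≤r | m≤n⇒m⊓n≡m b≤r = subst (i + r ≤_) i+u≡a+b (+-monoʳ-≤ i r≤u)

⊓-exchange₁ : ∀ r {i u a b} → i < a → i < b → a ≡ r → i ⊓ r + u ⊓ r + 1 ≤ a ⊓ r + b ⊓ r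
⊓-exchange₁ r {i} {u} {a} {b} i<a i<b refl = begin
  i ⊓ a + u ⊓ a + 1  ≡⟨ cong (λ x → x + u ⊓ a + 1) (m≤n⇒m⊓n≡m (<⇒≤ i<a)) ⟩
  i + u ⊓ a + 1      ≡⟨ +-comm (i + u ⊓ a) 1 ⟩
  suc i + u ⊓ a      ≤⟨ +-mono-≤ (⊓-glb i<b i<a) (m⊓n≤n u a) ⟩
  b ⊓ a + a          ≡⟨ +-comm (b ⊓ a) a ⟩
  a + b ⊓ a          ≡⟨ cong (_+ b ⊓ a) (sym (⊓-idem a)) ⟩
  a ⊓ a + b ⊓ a      ∎
  where open ≤-Reasoning

⊓-exchange₂ : ∀ r {i u a b} → i < a → a ≡ r → b ≡ r → suc i ≢ r → i ⊓ r + u ⊓ r + 2 ≤ a ⊓ r + b ⊓ r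
⊓-exchange₂ r {i} {u} i<r refl refl 1+i≢r = begin
  i ⊓ r + u ⊓ r + 2  ≤⟨ +-monoˡ-≤ 2 (+-mono-≤ (m⊓n≤m i r) (m⊓n≤n u r)) ⟩
  i + r + 2          ≡⟨ trans (+-assoc i r 2) (trans (cong (i +_) (+-comm r 2)) (sym (+-assoc i 2 r))) ⟩
  i + 2 + r          ≤⟨ +-monoˡ-≤ r (subst (_≤ r) (+-comm 2 i) (≤∧≢⇒< i<r 1+i≢r)) ⟩
  r + r              ≡⟨ sym (cong₂ _+_ (⊓-idem r) (⊓-idem r)) ⟩
  r ⊓ r + r ⊓ r      ∎
  where open ≤-Reasoning

-- For sparse δ, the rank function of the sparse paving matroid whose circuit-hyperplanes are the sets marked by δ.
truncatedRank : ∀ {n} → ℕ → (Subset n → ℕ) → Subset n → ℕ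
truncatedRank r δ Y = ∣ Y ∣ ⊓ r ∸ δ Y

record IsDefect {n} (r : ℕ) (δ : Subset n → ℕ) : Set where
  field
    δ≤1    : ∀ Y → δ Y ≤ 1
    δ-size : ∀ Y → δ Y ≡ 1 → ∣ Y ∣ ≡ r

Sparse : ∀ {n} → ℕ → (Subset n → ℕ) → Set
Sparse r δ = ∀ Y Z → δ Y ≡ 1 → δ Z ≡ 1 → suc ∣ Y ∩ Z ∣ ≢ r

module _ {n r} {δ : Subset n → ℕ} (1≤r : 1 ≤ r) (isDefect : IsDefect r δ) where
  open IsDefect isDefect

  δ≡0⊎δ≡1 : ∀ Y → δ Y ≡ 0 ⊎ δ Y ≡ 1
  δ≡0⊎δ≡1 Y with δ Y | δ≤1 Y
  ... | 0 | _ = inj₁ refl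
  ... | 1 | _ = inj₂ refl
  ... | suc (suc _) | s≤s ()

  δ≤∣∣⊓r : ∀ Y → δ Y ≤ ∣ Y ∣ ⊓ r
  δ≤∣∣⊓r Y with δ≡0⊎δ≡1 Y
  ... | inj₁ δY≡0 = subst (_≤ _) (sym δY≡0) z≤n
  ... | inj₂ δY≡1 = subst₂ _≤_ (sym δY≡1) (sym (trans (cong (_⊓ r) (δ-size Y δY≡1)) (⊓-idem r))) 1≤r

  truncatedRank+δ : ∀ Y → truncatedRank r δ Y + δ Y ≡ ∣ Y ∣ ⊓ r
  truncatedRank+δ Y = m∸n+n≡m (δ≤∣∣⊓r Y)

  truncatedRank-pair+δ : ∀ U V → truncatedRank r δ U + truncatedRank r δ V + (δ U + δ V) ≡ ∣ U ∣ ⊓ r + ∣ V ∣ ⊓ r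
  truncatedRank-pair+δ U V =
    trans (interchange (truncatedRank r δ U) _ (δ U) (δ V)) (cong₂ _+_ (truncatedRank+δ U) (truncatedRank+δ V))

  -- Submodularity of truncatedRank with the defects moved across, so that no truncated subtraction occurs.
  Exchange : Subset n → Subset n → Set
  Exchange Y Z = ∣ Y ∩ Z ∣ ⊓ r + ∣ Y ∪ Z ∣ ⊓ r + (δ Y + δ Z) ≤ ∣ Y ∣ ⊓ r + ∣ Z ∣ ⊓ r + (δ (Y ∩ Z) + δ (Y ∪ Z))

  exchange-sym : ∀ Y Z → Exchange Z Y → Exchange Y Z
  exchange-sym Y Z h rewrite ∩-comm Y Z | ∪-comm Y Z | +-comm (δ Y) (δ Z) | +-comm (∣ Y ∣ ⊓ r) (∣ Z ∣ ⊓ r) = h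

  exchange-⊆ : ∀ Y Z → ∣ Y ∩ Z ∣ ≡ ∣ Y ∣ → Exchange Y Z
  exchange-⊆ Y Z i≡a rewrite ∣p∩q∣≡∣p∣⇒p∩q≡p Y Z i≡a | ∣p∩q∣≡∣p∣⇒p∪q≡q Y Z i≡a = ≤-refl

  exchange-proper : Sparse r δ → ∀ Y Z → ∣ Y ∩ Z ∣ < ∣ Y ∣ → ∣ Y ∩ Z ∣ < ∣ Z ∣ →
                    ∣ Y ∩ Z ∣ ⊓ r + ∣ Y ∪ Z ∣ ⊓ r + (δ Y + δ Z) ≤ ∣ Y ∣ ⊓ r + ∣ Z ∣ ⊓ r
  exchange-proper sparse Y Z i<a i<b with δ≡0⊎δ≡1 Y | δ≡0⊎δ≡1 Z
  ... | inj₁ δY≡0 | inj₁ δZ≡0 rewrite δY≡0 | δZ≡0 =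
    subst (_≤ ∣ Y ∣ ⊓ r + ∣ Z ∣ ⊓ r) (sym (+-identityʳ _)) (⊓-concave r (∣p∩q∣+∣p∪q∣≡∣p∣+∣q∣ Y Z) (<⇒≤ i<a) (<⇒≤ i<b))
  ... | inj₂ δY≡1 | inj₁ δZ≡0 rewrite δY≡1 | δZ≡0 = ⊓-exchange₁ r {u = ∣ Y ∪ Z ∣} i<a i<b (δ-size Y δY≡1)
  ... | inj₁ δY≡0 | inj₂ δZ≡1 rewrite δY≡0 | δZ≡1 =
    subst (∣ Y ∩ Z ∣ ⊓ r + ∣ Y ∪ Z ∣ ⊓ r + 1 ≤_) (+-comm (∣ Z ∣ ⊓ r) (∣ Y ∣ ⊓ r))
      (⊓-exchange₁ r {u = ∣ Y ∪ Z ∣} i<b i<a (δ-size Z δZ≡1))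
  ... | inj₂ δY≡1 | inj₂ δZ≡1 rewrite δY≡1 | δZ≡1 =
    ⊓-exchange₂ r {u = ∣ Y ∪ Z ∣} i<a (δ-size Y δY≡1) (δ-size Z δZ≡1) (sparse Y Z δY≡1 δZ≡1)

  exchange : Sparse r δ → ∀ Y Z → Exchange Y Z
  exchange sparse Y Z with ∣ Y ∩ Z ∣ ℕ.≟ ∣ Y ∣ | ∣ Y ∩ Z ∣ ℕ.≟ ∣ Z ∣
  ... | yes i≡a | _       = exchange-⊆ Y Z i≡a
  ... | no _    | yes i≡b = exchange-sym Y Z (exchange-⊆ Z Y (trans (cong ∣_∣ (∩-comm Z Y)) i≡b))
  ... | no i≢a  | no i≢b  = ≤-trans (exchange-proper sparse Y Z (≤∧≢⇒< (∣p∩q∣≤∣p∣ Y Z) i≢a) (≤∧≢⇒< (∣p∩q∣≤∣q∣ Y Z) i≢b))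
                                    (m≤m+n _ _)

  truncatedRank-submodular : Sparse r δ → Submodular (truncatedRank r δ)
  truncatedRank-submodular sparse Y Z =
    +-cancelʳ-≤ (δ (Y ∩ Z) + δ (Y ∪ Z)) _ _ (+-cancelʳ-≤ (δ Y + δ Z) _ _ (begin
      ρ (Y ∩ Z) + ρ (Y ∪ Z) + (δ (Y ∩ Z) + δ (Y ∪ Z)) + (δ Y + δ Z)
        ≡⟨ cong (_+ (δ Y + δ Z)) (ρ-pair+δ (Y ∩ Z) (Y ∪ Z)) ⟩
      ∣ Y ∩ Z ∣ ⊓ r + ∣ Y ∪ Z ∣ ⊓ r + (δ Y + δ Z)
        ≤⟨ exchange sparse Y Z ⟩
      ∣ Y ∣ ⊓ r + ∣ Z ∣ ⊓ r + (δ (Y ∩ Z) + δ (Y ∪ Z))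
        ≡⟨ cong (_+ (δ (Y ∩ Z) + δ (Y ∪ Z))) (sym (ρ-pair+δ Y Z)) ⟩
      ρ Y + ρ Z + (δ Y + δ Z) + (δ (Y ∩ Z) + δ (Y ∪ Z))
        ≡⟨ trans (+-assoc (ρ Y + ρ Z) _ _) (trans (cong (ρ Y + ρ Z +_) (+-comm (δ Y + δ Z) _))
                                                  (sym (+-assoc (ρ Y + ρ Z) _ _))) ⟩
      ρ Y + ρ Z + (δ (Y ∩ Z) + δ (Y ∪ Z)) + (δ Y + δ Z) ∎))
    where
    open ≤-Reasoning
    ρ = truncatedRank r δ
    ρ-pair+δ = truncatedRank-pair+δ

  truncatedRank-bounded : ∀ Y → truncatedRank r δ Y ≤ ∣ Y ∣
  truncatedRank-bounded Y = ≤-trans (m∸n≤m (∣ Y ∣ ⊓ r) (δ Y)) (m⊓n≤m ∣ Y ∣ r)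

  truncatedRank-monotone : ∀ Y Z → Y ⊆ Z → truncatedRank r δ Y ≤ truncatedRank r δ Z
  truncatedRank-monotone Y Z Y⊆Z with ∣ Y ∣ ℕ.≟ ∣ Z ∣ | δ≡0⊎δ≡1 Z
  ... | yes a≡b | _ = ≤-reflexive (cong (truncatedRank r δ) (p⊆q∧∣p∣≡∣q∣⇒p≡q Y⊆Z a≡b))
  ... | no _ | inj₁ δZ≡0 rewrite δZ≡0 = ≤-trans (m∸n≤m (∣ Y ∣ ⊓ r) (δ Y)) (⊓-monoˡ-≤ r (p⊆q⇒∣p∣≤∣q∣ Y⊆Z))
  ... | no a≢b | inj₂ δZ≡1 rewrite δZ≡1 | δ-size Z δZ≡1 | ⊓-idem r =
    ≤-trans (truncatedRank-bounded Y) (suc[m]≤n⇒m≤pred[n] (≤∧≢⇒< (subst (∣ Y ∣ ≤_) (δ-size Z δZ≡1) (p⊆q⇒∣p∣≤∣q∣ Y⊆Z)) a≢b))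

  sparsePavingMatroid : Sparse r δ → Matroid n
  sparsePavingMatroid sparse = record
    { rank     = truncatedRank r δ
    ; bounded  = truncatedRank-bounded
    ; monotone = truncatedRank-monotone
    ; submod   = truncatedRank-submodular sparse
    }

truncatedRank-pair-cong : ∀ {n r} {δ δ′ : Subset n → ℕ} (1≤r : 1 ≤ r) → IsDefect r δ → IsDefect r δ′ → ∀ U V →
  δ U + δ V ≡ δ′ U + δ′ V → truncatedRank r δ U + truncatedRank r δ V ≡ truncatedRank r δ′ U + truncatedRank r δ′ V
truncatedRank-pair-cong {r = r} {δ} {δ′} 1≤r isDefect isDefect′ U V δ-sum≡ = +-cancelʳ-≡ (δ U + δ V) _ _ (begin
  truncatedRank r δ U + truncatedRank r δ V + (δ U + δ V)       ≡⟨ truncatedRank-pair+δ 1≤r isDefect U V ⟩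
  ∣ U ∣ ⊓ r + ∣ V ∣ ⊓ r                                         ≡⟨ sym (truncatedRank-pair+δ 1≤r isDefect′ U V) ⟩
  truncatedRank r δ′ U + truncatedRank r δ′ V + (δ′ U + δ′ V)   ≡⟨ cong (truncatedRank r δ′ U + truncatedRank r δ′ V +_) (sym δ-sum≡) ⟩
  truncatedRank r δ′ U + truncatedRank r δ′ V + (δ U + δ V)     ∎)
  where open ≡-Reasoning

-- The connectivity function of an odd cycle of sets

odd : ℕ → Bool
odd zero    = false
odd (suc i) = not (odd i)

alternating⇒≡xor-odd : ∀ {N} (b : ℕ → Bool) → (∀ i → suc i < N → b (suc i) ≡ not (b i)) →
                       ∀ i → i < N → b i ≡ b 0 xor odd i
alternating⇒≡xor-odd b alternating zero    _      = sym (xor-identityʳ (b 0))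
alternating⇒≡xor-odd b alternating (suc i) 1+i<N = begin
  b (suc i)            ≡⟨ alternating i 1+i<N ⟩
  not (b i)            ≡⟨ cong not (alternating⇒≡xor-odd b alternating i (<-trans (n<1+n i) 1+i<N)) ⟩
  not (b 0 xor odd i)  ≡⟨ not-distribʳ-xor (b 0) (odd i) ⟩
  b 0 xor odd (suc i)  ∎
  where open ≡-Reasoning

Adjacent : ℕ → ℕ → ℕ → Set
Adjacent N i k = suc i ≡ k ⊎ suc k ≡ i ⊎ (i ≡ 0 × suc k ≡ N) ⊎ (k ≡ 0 × suc i ≡ N)

-- A proper 2-colouring of the path left from the cycle 0, 1, …, N - 1 after deleting v.
colour : ℕ → ℕ → Bool
colour v i = odd i xor does (i ℕ.<? v)

colour-suc : ∀ v i → suc i ≢ v → colour v (suc i) ≡ not (colour v i)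
colour-suc v i 1+i≢v = trans (cong (not (odd i) xor_) same-side) (sym (not-distribˡ-xor (odd i) _))
  where
  same-side : does (suc i ℕ.<? v) ≡ does (i ℕ.<? v)
  same-side with i ℕ.<? v
  ... | yes i<v = trans (dec-true (suc i ℕ.<? v) (≤∧≢⇒< i<v 1+i≢v)) (sym (dec-true (i ℕ.<? v) i<v))
  ... | no  i≮v = trans (dec-false (suc i ℕ.<? v) (λ 1+i<v → i≮v (<-trans (n<1+n i) 1+i<v)))
                        (sym (dec-false (i ℕ.<? v) i≮v))

colour-first : ∀ {v} → 0 ≢ v → colour v 0 ≡ true
colour-first {v} 0≢v = dec-true (0 ℕ.<? v) (n≢0⇒n>0 (≢-sym 0≢v))

colour-last : ∀ {N′ v} → odd N′ ≡ false → v < suc N′ → N′ ≢ v → colour v N′ ≡ false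
colour-last {N′} {v} N′-even v<N N′≢v rewrite N′-even =
  dec-false (N′ ℕ.<? v) (λ N′<v → <-irrefl refl (<-≤-trans N′<v (≤-pred v<N)))

colour-adjacent : ∀ {N′ v i k} → odd N′ ≡ false → v < suc N′ → i ≢ v → k ≢ v →
                  Adjacent (suc N′) i k → colour v i ≢ colour v k
colour-adjacent {v = v} {i} _ _ _ k≢v (inj₁ refl) e = not-¬ refl (trans e (colour-suc v i k≢v))
colour-adjacent {v = v} {k = k} _ _ i≢v _ (inj₂ (inj₁ refl)) e = not-¬ refl (trans (sym e) (colour-suc v k i≢v))
colour-adjacent N′-even v<N i≢v k≢v (inj₂ (inj₂ (inj₁ (refl , 1+k≡N)))) e
  rewrite suc-injective 1+k≡N with () ← trans (sym (colour-first i≢v)) (trans e (colour-last N′-even v<N k≢v))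
colour-adjacent N′-even v<N i≢v k≢v (inj₂ (inj₂ (inj₂ (refl , 1+i≡N)))) e
  rewrite suc-injective 1+i≡N with () ← trans (sym (colour-first k≢v)) (trans (sym e) (colour-last N′-even v<N i≢v))

-- For the matroid attached to the deleted vertex v: whether X i (side false) or ∁ X i (side true) is lowered.
pairDefect : ℕ → ℕ → Bool → ℕ
pairDefect v i side = if i ℕ.≡ᵇ v then 0 else (if colour v i xor side then 0 else 1)

pairDefect-≤1 : ∀ v i side → pairDefect v i side ≤ 1
pairDefect-≤1 v i side with i ℕ.≡ᵇ v | colour v i xor side
... | true  | _     = z≤n
... | false | true  = z≤n
... | false | false = s≤s z≤n

pairDefect≡1⇒ : ∀ v i side → pairDefect v i side ≡ 1 → i ≢ v × colour v i ≡ side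
pairDefect≡1⇒ v i side e with i ℕ.≡ᵇ v in i≡ᵇv | colour v i
... | false | false with false ← side = (λ i≡v → subst T i≡ᵇv (≡⇒≡ᵇ i v i≡v)) , refl
... | false | true  with true  ← side = (λ i≡v → subst T i≡ᵇv (≡⇒≡ᵇ i v i≡v)) , refl

pairDefect-complementary : ∀ {v i} → i ≢ v → pairDefect v i false + pairDefect v i true ≡ 1
pairDefect-complementary {v} {i} i≢v rewrite dec-false (i ℕ.≟ v) i≢v with colour v i
... | true  = refl
... | false = refl

MatroidalOn : ∀ {n} → (Subset n → ℚ) → List (Subset n) → Set
MatroidalOn {n} f 𝒜 = ∃ λ (M : Matroid n) → All (λ X → μ M X ≡ f X) 𝒜

Certifies : ∀ {n} → List (Subset n) → (Subset n → ℚ) → Set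
Certifies {n} 𝒜 f = (g : Subset n → ℚ) → IsConnectivityFunction g → All (λ X → g X ≡ f X) 𝒜 → ¬ IsMatroidConnectivity g

matroidalOn⇒¬certifies : ∀ {n} {f} {𝒜 : List (Subset n)} → MatroidalOn f 𝒜 → ¬ Certifies 𝒜 f
matroidalOn⇒¬certifies (M , μM≡f) certifies = certifies (μ M) (μ-isConnectivityFunction M) μM≡f (M , λ _ → refl)

matroidalOn-quadruples⇒isConnectivityFunction : ∀ {n} {f : Subset n → ℚ} →
  (∀ 𝒜 → length 𝒜 ≤ 4 → MatroidalOn f 𝒜) → IsConnectivityFunction f
matroidalOn-quadruples⇒isConnectivityFunction {f = f} matroidalOn = record
  { empty     = f-empty (matroidalOn (⊥ ∷ []) (s≤s z≤n))
  ; symmetric = λ X → f-symmetric X (matroidalOn (X ∷ ∁ X ∷ []) (s≤s (s≤s z≤n)))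
  ; submod    = λ X Y → f-submod X Y (matroidalOn (X ∩ Y ∷ X ∪ Y ∷ X ∷ Y ∷ []) ≤-refl)
  }
  where
  open IsConnectivityFunction
  f-empty : MatroidalOn f (⊥ ∷ []) → f ⊥ ≡ 0ℚ
  f-empty (M , μM⊥ ∷ []) = trans (sym μM⊥) (empty (μ-isConnectivityFunction M))
  f-symmetric : ∀ X → MatroidalOn f (X ∷ ∁ X ∷ []) → f X ≡ f (∁ X)
  f-symmetric X (M , μMX ∷ μM∁X ∷ []) = trans (sym μMX) (trans (symmetric (μ-isConnectivityFunction M) X) μM∁X)
  f-submod : ∀ X Y → MatroidalOn f (X ∩ Y ∷ X ∪ Y ∷ X ∷ Y ∷ []) → f (X ∩ Y) ℚ.+ f (X ∪ Y) ℚ.≤ f X ℚ.+ f Y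
  f-submod X Y (M , μM∩ ∷ μM∪ ∷ μMX ∷ μMY ∷ []) =
    subst₂ ℚ._≤_ (cong₂ ℚ._+_ μM∩ μM∪) (cong₂ ℚ._+_ μMX μMY) (submod (μ-isConnectivityFunction M) X Y)

boundedSearch : ∀ {P : ℕ → Set} N → (∀ i → Dec (P i)) → (∃ λ i → i < N × P i) ⊎ (∀ i → i < N → ¬ P i)
boundedSearch {P} N P? with anyFin? (λ (i : Fin N) → P? (toℕ i))
... | yes (i , p) = inj₁ (toℕ i , toℕ<n i , p)
... | no ∄p       = inj₂ (λ i i<N p → ∄p (fromℕ< i<N , subst P (sym (toℕ-fromℕ< i<N)) p))

unblocked : ∀ {A : Set} {N} (Blocks : A → ℕ → Set) → (∀ a v → Dec (Blocks a v)) →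
  (∀ {a v w} → v < N → w < N → Blocks a v → Blocks a w → v ≡ w) →
  (𝒜 : List A) → length 𝒜 < N → ∃ λ v → v < N × All (λ a → ¬ Blocks a v) 𝒜
unblocked {N = N} Blocks Blocks? blocks-unique 𝒜 ∣𝒜∣<N
  with ¬∀⟶∃¬ N (λ (v : Fin N) → Any (λ a → Blocks a (toℕ v)) 𝒜) (λ v → any? (λ a → Blocks? a (toℕ v)) 𝒜) all-blocked
  where
  all-blocked : ¬ (∀ (v : Fin N) → Any (λ a → Blocks a (toℕ v)) 𝒜)
  all-blocked blocker = <⇒≱ ∣𝒜∣<N (injective⇒≤ {f = blockerIndex} blockerIndex-injective)
    where
    blockerIndex : Fin N → Fin (length 𝒜)
    blockerIndex v = Any.index (blocker v)
    blockerIndex-injective : ∀ {v w} → blockerIndex v ≡ blockerIndex w → v ≡ w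
    blockerIndex-injective {v} {w} e = toℕ-injective (blocks-unique (toℕ<n v) (toℕ<n w) (lookup-index (blocker v))
      (subst (λ i → Blocks (lookup 𝒜 i) (toℕ w)) (sym e) (lookup-index (blocker w))))
... | v , v-free = toℕ v , toℕ<n v , ¬Any⇒All¬ 𝒜 v-free

record OddCycleOfHalves (n : ℕ) : Set where
  field
    r                 : ℕ
    n≡r+r             : n ≡ r + r
    N′                : ℕ
    X                 : ℕ → Subset n
    ∣X∣≡r             : ∀ i → i < suc N′ → ∣ X i ∣ ≡ r
    2≤∣X∩X∣           : ∀ i k → i < suc N′ → k < suc N′ → 2 ≤ ∣ X i ∩ X k ∣
    ∣X∩X∣≡r⇒≡         : ∀ i k → i < suc N′ → k < suc N′ → ∣ X i ∩ X k ∣ ≡ r → i ≡ k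
    1+∣X∩X∣≡r⇒adjacent : ∀ i k → i < suc N′ → k < suc N′ → suc ∣ X i ∩ X k ∣ ≡ r → Adjacent (suc N′) i k
    consecutive-near  : ∀ i → suc i < suc N′ → suc ∣ X i ∩ X (suc i) ∣ ≡ r
    last-near-first   : suc ∣ X N′ ∩ X 0 ∣ ≡ r
    N′-even           : odd N′ ≡ false
    4≤N′              : 4 ≤ N′
    -- an r-set outside the cycle; it forces every matroid realising the cycle's connectivity to have rank r
    Y₀                : Subset n
    ∣Y₀∣≡r            : ∣ Y₀ ∣ ≡ r
    Y₀≢X              : ∀ i → i < suc N′ → Y₀ ≢ X i
    Y₀≢∁X             : ∀ i → i < suc N′ → Y₀ ≢ ∁ (X i)

module OddCycle {n} (𝒞 : OddCycleOfHalves n) where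
  open OddCycleOfHalves 𝒞

  N : ℕ
  N = suc N′

  ∣p∣≡r⇒∣∁p∣≡r : ∀ (p : Subset n) → ∣ p ∣ ≡ r → ∣ ∁ p ∣ ≡ r
  ∣p∣≡r⇒∣∁p∣≡r p ∣p∣≡r = +-cancelʳ-≡ r _ _ (trans (subst (λ k → ∣ ∁ p ∣ + k ≡ n) ∣p∣≡r (∣∁p∣+∣p∣≡n p)) n≡r+r)

  ∣∁p∩∁q∣≡∣p∩q∣ : ∀ (p q : Subset n) → ∣ p ∣ ≡ r → ∣ q ∣ ≡ r → ∣ ∁ p ∩ ∁ q ∣ ≡ ∣ p ∩ q ∣
  ∣∁p∩∁q∣≡∣p∩q∣ p q ∣p∣≡r ∣q∣≡r = +-cancelʳ-≡ ∣ p ∪ q ∣ _ _ (begin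
    ∣ ∁ p ∩ ∁ q ∣ + ∣ p ∪ q ∣  ≡⟨ cong (λ Z → ∣ Z ∣ + ∣ p ∪ q ∣) (sym (∁-∪ p q)) ⟩
    ∣ ∁ (p ∪ q) ∣ + ∣ p ∪ q ∣  ≡⟨ ∣∁p∣+∣p∣≡n (p ∪ q) ⟩
    n                          ≡⟨ n≡r+r ⟩
    r + r                      ≡⟨ sym (cong₂ _+_ ∣p∣≡r ∣q∣≡r) ⟩
    ∣ p ∣ + ∣ q ∣              ≡⟨ sym (∣p∩q∣+∣p∪q∣≡∣p∣+∣q∣ p q) ⟩
    ∣ p ∩ q ∣ + ∣ p ∪ q ∣      ∎)
    where open ≡-Reasoning

  2≤r : 2 ≤ r
  2≤r = subst (2 ≤_) (trans (cong ∣_∣ (∩-idem (X 0))) (∣X∣≡r 0 z<s)) (2≤∣X∩X∣ 0 0 z<s z<s)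

  1≤r : 1 ≤ r
  1≤r = ≤-trans (s≤s z≤n) 2≤r

  ∣⊤∣≢r : ∣ ⊤ {n} ∣ ≢ r
  ∣⊤∣≢r ∣⊤∣≡r = <⇒≢ (<-≤-trans z<s 1≤r) (sym (+-cancelʳ-≡ r r 0 (trans (sym n≡r+r) (trans (sym (∣⊤∣≡n n)) ∣⊤∣≡r))))

  X-injective : ∀ {i k} → i < N → k < N → X i ≡ X k → i ≡ k
  X-injective {i} {k} i<N k<N Xi≡Xk =
    ∣X∩X∣≡r⇒≡ i k i<N k<N (trans (cong (λ Z → ∣ X i ∩ Z ∣) (sym Xi≡Xk)) (trans (cong ∣_∣ (∩-idem (X i))) (∣X∣≡r i i<N)))

  X≢∁X : ∀ {i k} → i < N → k < N → X i ≢ ∁ (X k)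
  X≢∁X {i} {k} i<N k<N Xi≡∁Xk = <⇒≱ (s≤s z≤n) (subst (2 ≤_) ∣∁Xk∩Xk∣≡0 (2≤∣X∩X∣ i k i<N k<N))
    where
    ∣∁Xk∩Xk∣≡0 : ∣ X i ∩ X k ∣ ≡ 0
    ∣∁Xk∩Xk∣≡0 = trans (cong (λ Z → ∣ Z ∩ X k ∣) Xi≡∁Xk)
                       (trans (cong ∣_∣ (trans (∩-comm (∁ (X k)) (X k)) (∩-inverseʳ (X k)))) (∣⊥∣≡0 n))

  1+∣X∩∁X∣≢r : ∀ i k → i < N → k < N → suc ∣ X i ∩ ∁ (X k) ∣ ≢ r
  1+∣X∩∁X∣≢r i k i<N k<N 1+∣Xi∩∁Xk∣≡r = <⇒≱ (s≤s (s≤s z≤n)) (subst (2 ≤_) ∣Xi∩Xk∣≡1 (2≤∣X∩X∣ i k i<N k<N))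
    where
    ∣Xi∩Xk∣≡1 : ∣ X i ∩ X k ∣ ≡ 1
    ∣Xi∩Xk∣≡1 = +-cancelˡ-≡ ∣ X i ∩ ∁ (X k) ∣ _ _
      (trans (trans (∣p∩∁q∣+∣p∩q∣≡∣p∣ (X i) (X k)) (∣X∣≡r i i<N)) (trans (sym 1+∣Xi∩∁Xk∣≡r) (+-comm 1 _)))

  _≟ˢ_ : (p q : Subset n) → Dec (p ≡ q)
  _≟ˢ_ = ≡-dec Data.Bool._≟_

  data CycleView (Y : Subset n) : Set where
    member     : ∀ i → i < N → Y ≡ X i → CycleView Y
    complement : ∀ i → i < N → Y ≡ ∁ (X i) → CycleView Y
    outside    : (∀ i → i < N → Y ≢ X i) → (∀ i → i < N → Y ≢ ∁ (X i)) → CycleView Y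

  abstract
    view : ∀ Y → CycleView Y
    view Y with boundedSearch N (λ i → Y ≟ˢ X i) | boundedSearch N (λ i → Y ≟ˢ ∁ (X i))
    ... | inj₁ (i , i<N , Y≡Xi) | _                      = member i i<N Y≡Xi
    ... | inj₂ _                | inj₁ (i , i<N , Y≡∁Xi) = complement i i<N Y≡∁Xi
    ... | inj₂ Y∉X              | inj₂ Y∉∁X              = outside Y∉X Y∉∁X

  memberDefectᵛ : ∀ {Y} → CycleView Y → ℕ
  memberDefectᵛ (member _ _ _)     = 1
  memberDefectᵛ (complement _ _ _) = 0
  memberDefectᵛ (outside _ _)      = 0

  memberDefect : Subset n → ℕ
  memberDefect Y = memberDefectᵛ (view Y)

  vertexDefectᵛ : ℕ → ∀ {Y} → CycleView Y → ℕ
  vertexDefectᵛ v (member i _ _)     = pairDefect v i false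
  vertexDefectᵛ v (complement i _ _) = pairDefect v i true
  vertexDefectᵛ v (outside _ _)      = 0

  vertexDefect : ℕ → Subset n → ℕ
  vertexDefect v Y = vertexDefectᵛ v (view Y)

  memberDefect-isDefect : IsDefect r memberDefect
  memberDefect-isDefect = record { δ≤1 = λ Y → ≤1 (view Y) ; δ-size = λ Y → size (view Y) }
    where
    ≤1 : ∀ {Y} (c : CycleView Y) → memberDefectᵛ c ≤ 1
    ≤1 (member _ _ _)     = s≤s z≤n
    ≤1 (complement _ _ _) = z≤n
    ≤1 (outside _ _)      = z≤n
    size : ∀ {Y} (c : CycleView Y) → memberDefectᵛ c ≡ 1 → ∣ Y ∣ ≡ r
    size (member i i<N refl) _ = ∣X∣≡r i i<N

  vertexDefect-isDefect : ∀ v → IsDefect r (vertexDefect v)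
  vertexDefect-isDefect v = record { δ≤1 = λ Y → ≤1 (view Y) ; δ-size = λ Y → size (view Y) }
    where
    ≤1 : ∀ {Y} (c : CycleView Y) → vertexDefectᵛ v c ≤ 1
    ≤1 (member i _ _)     = pairDefect-≤1 v i false
    ≤1 (complement i _ _) = pairDefect-≤1 v i true
    ≤1 (outside _ _)      = z≤n
    size : ∀ {Y} (c : CycleView Y) → vertexDefectᵛ v c ≡ 1 → ∣ Y ∣ ≡ r
    size (member i i<N refl) _     = ∣X∣≡r i i<N
    size (complement i i<N refl) _ = ∣p∣≡r⇒∣∁p∣≡r (X i) (∣X∣≡r i i<N)

  -- Lowered sets of one colour are never adjacent on the cycle, and X i, ∁ X k never meet in r - 1 elements.
  vertexDefect-sparse : ∀ {v} → v < N → Sparse r (vertexDefect v)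
  vertexDefect-sparse {v} v<N Y Z δY≡1 δZ≡1 = sparse (view Y) (view Z) δY≡1 δZ≡1
    where
    same-colour-far : ∀ {i k} side → i < N → k < N → pairDefect v i side ≡ 1 → pairDefect v k side ≡ 1 →
                      suc ∣ X i ∩ X k ∣ ≢ r
    same-colour-far {i} {k} side i<N k<N δi≡1 δk≡1 near with pairDefect≡1⇒ v i side δi≡1 | pairDefect≡1⇒ v k side δk≡1
    ... | i≢v , colour-i | k≢v , colour-k = colour-adjacent N′-even v<N i≢v k≢v
          (1+∣X∩X∣≡r⇒adjacent i k i<N k<N near) (trans colour-i (sym colour-k))
    sparse : ∀ {Y Z} (c : CycleView Y) (d : CycleView Z) → vertexDefectᵛ v c ≡ 1 → vertexDefectᵛ v d ≡ 1 →
             suc ∣ Y ∩ Z ∣ ≢ r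
    sparse (member i i<N refl) (member k k<N refl) δY≡1 δZ≡1 = same-colour-far false i<N k<N δY≡1 δZ≡1
    sparse (complement i i<N refl) (complement k k<N refl) δY≡1 δZ≡1 near =
      same-colour-far true i<N k<N δY≡1 δZ≡1 (trans (cong suc (sym (∣∁p∩∁q∣≡∣p∩q∣ (X i) (X k) (∣X∣≡r i i<N) (∣X∣≡r k k<N)))) near)
    sparse (member i i<N refl) (complement k k<N refl) _ _ = 1+∣X∩∁X∣≢r i k i<N k<N
    sparse (complement i i<N refl) (member k k<N refl) _ _ near =
      1+∣X∩∁X∣≢r k i k<N i<N (trans (cong (λ Z → suc ∣ Z ∣) (∩-comm (X k) (∁ (X i)))) near)

  vertexMatroid : ∀ {v} → v < N → Matroid n
  vertexMatroid {v} v<N = sparsePavingMatroid 1≤r (vertexDefect-isDefect v) (vertexDefect-sparse v<N)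

  cycleConnectivity : Subset n → ℚ
  cycleConnectivity = connectivityOf (truncatedRank r memberDefect)

  Blocks : Subset n → ℕ → Set
  Blocks Y v = Y ≡ X v ⊎ Y ≡ ∁ (X v)

  blocks? : ∀ Y v → Dec (Blocks Y v)
  blocks? Y v = (Y ≟ˢ X v) ⊎-dec (Y ≟ˢ ∁ (X v))

  blocks-unique : ∀ {Y v w} → v < N → w < N → Blocks Y v → Blocks Y w → v ≡ w
  blocks-unique v<N w<N (inj₁ Y≡Xv)  (inj₁ Y≡Xw)  = X-injective v<N w<N (trans (sym Y≡Xv) Y≡Xw)
  blocks-unique v<N w<N (inj₁ Y≡Xv)  (inj₂ Y≡∁Xw) = ⊥-elim (X≢∁X v<N w<N (trans (sym Y≡Xv) Y≡∁Xw))
  blocks-unique v<N w<N (inj₂ Y≡∁Xv) (inj₁ Y≡Xw)  = ⊥-elim (X≢∁X w<N v<N (trans (sym Y≡Xw) Y≡∁Xv))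
  blocks-unique v<N w<N (inj₂ Y≡∁Xv) (inj₂ Y≡∁Xw) = X-injective v<N w<N (∁-injective (trans (sym Y≡∁Xv) Y≡∁Xw))

  -- Away from X v and ∁ X v, both defects lower exactly one set of each pair {X i, ∁ X i}.
  defect-pair-sum : ∀ {v Y} → ¬ Blocks Y v → (c : CycleView Y) (c′ : CycleView (∁ Y)) →
                    memberDefectᵛ c + memberDefectᵛ c′ ≡ vertexDefectᵛ v c + vertexDefectᵛ v c′
  defect-pair-sum _ (member i i<N refl) (member k k<N ∁Xi≡Xk) = ⊥-elim (X≢∁X k<N i<N (sym ∁Xi≡Xk))
  defect-pair-sum {v} unblocked (member i i<N refl) (complement k k<N ∁Xi≡∁Xk)
    with refl ← X-injective k<N i<N (sym (∁-injective ∁Xi≡∁Xk)) =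
    sym (pairDefect-complementary (λ i≡v → unblocked (inj₁ (cong X i≡v))))
  defect-pair-sum _ (member i i<N refl) (outside _ ∁Xi∉∁X) = ⊥-elim (∁Xi∉∁X i i<N refl)
  defect-pair-sum {v} unblocked (complement i i<N refl) (member k k<N ∁∁Xi≡Xk)
    with refl ← X-injective k<N i<N (trans (sym ∁∁Xi≡Xk) (∁-involutive (X i))) =
    sym (trans (+-comm (pairDefect v i true) _) (pairDefect-complementary (λ i≡v → unblocked (inj₂ (cong (λ j → ∁ (X j)) i≡v)))))
  defect-pair-sum _ (complement i i<N refl) (complement k k<N ∁∁Xi≡∁Xk) =
    ⊥-elim (X≢∁X i<N k<N (trans (sym (∁-involutive (X i))) ∁∁Xi≡∁Xk))
  defect-pair-sum _ (complement i i<N refl) (outside ∁∁Xi∉X _) = ⊥-elim (∁∁Xi∉X i i<N (∁-involutive (X i)))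
  defect-pair-sum {Y = Y} _ (outside _ Y∉∁X) (member k k<N ∁Y≡Xk) =
    ⊥-elim (Y∉∁X k k<N (trans (sym (∁-involutive Y)) (cong ∁ ∁Y≡Xk)))
  defect-pair-sum {Y = Y} _ (outside Y∉X _) (complement k k<N ∁Y≡∁Xk) = ⊥-elim (Y∉X k k<N (∁-injective ∁Y≡∁Xk))
  defect-pair-sum _ (outside _ _) (outside _ _) = refl

  truncatedRank-⊤ : ∀ {δ} → IsDefect r δ → truncatedRank r δ ⊤ ≡ r
  truncatedRank-⊤ {δ} isDefect with δ≡0⊎δ≡1 1≤r isDefect (⊤ {n})
  ... | inj₁ δ⊤≡0 rewrite δ⊤≡0 = m≥n⇒m⊓n≡n (subst (r ≤_) (sym (trans (∣⊤∣≡n n) n≡r+r)) (m≤n+m r r))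
  ... | inj₂ δ⊤≡1 = ⊥-elim (∣⊤∣≢r (IsDefect.δ-size isDefect ⊤ δ⊤≡1))

  cycleConnectivity≡μ : ∀ {v} (v<N : v < N) Y → ¬ Blocks Y v → cycleConnectivity Y ≡ μ (vertexMatroid v<N) Y
  cycleConnectivity≡μ {v} v<N Y unblocked = connectivityOf-cong (truncatedRank r memberDefect) (truncatedRank r (vertexDefect v)) Y
    (truncatedRank-pair-cong 1≤r memberDefect-isDefect (vertexDefect-isDefect v) Y (∁ Y)
      (defect-pair-sum unblocked (view Y) (view (∁ Y))))
    (trans (truncatedRank-⊤ memberDefect-isDefect) (sym (truncatedRank-⊤ (vertexDefect-isDefect v))))

  cycleConnectivity-matroidalOn : ∀ 𝒜 → length 𝒜 < N → MatroidalOn cycleConnectivity 𝒜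
  cycleConnectivity-matroidalOn 𝒜 ∣𝒜∣<N = matroidalOn (unblocked Blocks blocks? blocks-unique 𝒜 ∣𝒜∣<N)
    where
    matroidalOn : ∃ (λ v → v < N × All (λ Y → ¬ Blocks Y v) 𝒜) → MatroidalOn cycleConnectivity 𝒜
    matroidalOn (v , v<N , unblocked-by-𝒜) =
      vertexMatroid v<N , All.map (λ {Y} → sym ∘ cycleConnectivity≡μ v<N Y) unblocked-by-𝒜

  cycleConnectivity-isConnectivityFunction : IsConnectivityFunction cycleConnectivity
  cycleConnectivity-isConnectivityFunction = matroidalOn-quadruples⇒isConnectivityFunction
    (λ 𝒜 ∣𝒜∣≤4 → cycleConnectivity-matroidalOn 𝒜 (s≤s (≤-trans ∣𝒜∣≤4 4≤N′)))

  memberDefect-X : ∀ i → i < N → memberDefect (X i) ≡ 1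
  memberDefect-X i i<N with view (X i)
  ... | member _ _ _              = refl
  ... | complement k k<N Xi≡∁Xk   = ⊥-elim (X≢∁X i<N k<N Xi≡∁Xk)
  ... | outside Xi∉X _            = ⊥-elim (Xi∉X i i<N refl)

  memberDefect-non-member : ∀ Y → (∀ i → i < N → Y ≢ X i) → memberDefect Y ≡ 0
  memberDefect-non-member Y Y∉X with view Y
  ... | member i i<N Y≡Xi = ⊥-elim (Y∉X i i<N Y≡Xi)
  ... | complement _ _ _  = refl
  ... | outside _ _       = refl

  -- In a matroid realising the cycle's connectivity, exactly one set of each pair {X i, ∁ X i} has rank r - 1;
  -- neighbouring pairs must choose differently, which the odd cycle forbids.
  module _ (M : Matroid n) (f≡μM : ∀ X → cycleConnectivity X ≡ μ M X) where
    open Matroid M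
    ρ : Subset n → ℕ
    ρ = truncatedRank r memberDefect

    ρ≡∣∣⊓r : ∀ Y → (∀ i → i < N → Y ≢ X i) → ρ Y ≡ ∣ Y ∣ ⊓ r
    ρ≡∣∣⊓r Y Y∉X = cong (∣ Y ∣ ⊓ r ∸_) (memberDefect-non-member Y Y∉X)

    size-r⇒ρ≡r : ∀ Y → ∣ Y ∣ ≡ r → (∀ i → i < N → Y ≢ X i) → ρ Y ≡ r
    size-r⇒ρ≡r Y ∣Y∣≡r Y∉X = trans (ρ≡∣∣⊓r Y Y∉X) (trans (cong (_⊓ r) ∣Y∣≡r) (⊓-idem r))

    ∁X∉X : ∀ i → i < N → ∀ k → k < N → ∁ (X i) ≢ X k
    ∁X∉X i i<N k k<N ∁Xi≡Xk = X≢∁X k<N i<N (sym ∁Xi≡Xk)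

    rank-pair : ∀ Y → ρ Y + ρ (∁ Y) + rank ⊤ ≡ rank Y + rank (∁ Y) + r
    rank-pair Y = trans (connectivityOf-injective ρ rank Y (f≡μM Y))
                        (cong (rank Y + rank (∁ Y) +_) (truncatedRank-⊤ memberDefect-isDefect))

    r+rank⊤≡ : r + rank ⊤ ≡ rank Y₀ + rank (∁ Y₀)
    r+rank⊤≡ = +-cancelˡ-≡ r _ _ (begin
      r + (r + rank ⊤)            ≡⟨ sym (+-assoc r r (rank ⊤)) ⟩
      r + r + rank ⊤              ≡⟨ cong₂ (λ a b → a + b + rank ⊤)
                                       (sym (size-r⇒ρ≡r Y₀ ∣Y₀∣≡r Y₀≢X))
                                       (sym (size-r⇒ρ≡r (∁ Y₀) (∣p∣≡r⇒∣∁p∣≡r Y₀ ∣Y₀∣≡r) ∁Y₀∉X)) ⟩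
      ρ Y₀ + ρ (∁ Y₀) + rank ⊤    ≡⟨ rank-pair Y₀ ⟩
      rank Y₀ + rank (∁ Y₀) + r   ≡⟨ +-comm _ r ⟩
      r + (rank Y₀ + rank (∁ Y₀)) ∎)
      where
      open ≡-Reasoning
      ∁Y₀∉X : ∀ i → i < N → ∁ Y₀ ≢ X i
      ∁Y₀∉X i i<N ∁Y₀≡Xi = Y₀≢∁X i i<N (trans (sym (∁-involutive Y₀)) (cong ∁ ∁Y₀≡Xi))

    rank⊤≡r : rank ⊤ ≡ r
    rank⊤≡r = ≤-antisym
      (+-cancelˡ-≤ r (rank ⊤) r (subst (_≤ r + r) (sym r+rank⊤≡)
        (+-mono-≤ (subst (rank Y₀ ≤_) ∣Y₀∣≡r (bounded Y₀))
                  (subst (rank (∁ Y₀) ≤_) (∣p∣≡r⇒∣∁p∣≡r Y₀ ∣Y₀∣≡r) (bounded (∁ Y₀))))))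
      (+-cancelʳ-≤ (rank ⊤) r (rank ⊤) (subst (_≤ rank ⊤ + rank ⊤) (sym r+rank⊤≡)
        (+-mono-≤ (monotone Y₀ ⊤ ⊆⊤) (monotone (∁ Y₀) ⊤ ⊆⊤))))

    rank≤r : ∀ W → rank W ≤ r
    rank≤r W = subst (rank W ≤_) rank⊤≡r (monotone W ⊤ ⊆⊤)

    rank-pair′ : ∀ Y → ρ Y + ρ (∁ Y) ≡ rank Y + rank (∁ Y)
    rank-pair′ Y = +-cancelʳ-≡ r _ _ (trans (cong (ρ Y + ρ (∁ Y) +_) (sym rank⊤≡r)) (rank-pair Y))

    near-rank : ∀ W → suc ∣ W ∣ ≡ r → rank W ≡ ∣ W ∣ × rank (∁ W) ≡ r
    near-rank W 1+∣W∣≡r = +-≡-componentwise ∣W∣+r≡ (bounded W) (rank≤r (∁ W))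
      where
      ∣W∣<r : ∣ W ∣ < r
      ∣W∣<r = ≤-reflexive 1+∣W∣≡r
      W∉X : ∀ i → i < N → W ≢ X i
      W∉X i i<N W≡Xi = <-irrefl (trans (cong ∣_∣ W≡Xi) (∣X∣≡r i i<N)) ∣W∣<r
      ∁W∉X : ∀ i → i < N → ∁ W ≢ X i
      ∁W∉X i i<N ∁W≡Xi = <-irrefl (+-cancelˡ-≡ r ∣ W ∣ r (subst (λ k → k + ∣ W ∣ ≡ r + r)
        (trans (cong ∣_∣ ∁W≡Xi) (∣X∣≡r i i<N)) (trans (∣∁p∣+∣p∣≡n W) n≡r+r))) ∣W∣<r
      r≤∣∁W∣ : r ≤ ∣ ∁ W ∣
      r≤∣∁W∣ = +-cancelʳ-≤ (∣ W ∣) r (∣ ∁ W ∣) (subst (r + ∣ W ∣ ≤_) (sym (trans (∣∁p∣+∣p∣≡n W) n≡r+r))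
                 (+-monoʳ-≤ r (<⇒≤ ∣W∣<r)))
      ∣W∣+r≡ : ∣ W ∣ + r ≡ rank W + rank (∁ W)
      ∣W∣+r≡ = trans (sym (cong₂ _+_ (trans (ρ≡∣∣⊓r W W∉X) (m≤n⇒m⊓n≡m (<⇒≤ ∣W∣<r)))
                                      (trans (ρ≡∣∣⊓r (∁ W) ∁W∉X) (m≥n⇒m⊓n≡n r≤∣∁W∣))))
                     (rank-pair′ W)

    cycle-rank-sum : ∀ i → i < N → rank (X i) + rank (∁ (X i)) ≡ r ∸ 1 + r
    cycle-rank-sum i i<N = trans (sym (rank-pair′ (X i))) (cong₂ _+_ ρXi≡r∸1 ρ∁Xi≡r)
      where
      ρXi≡r∸1 : ρ (X i) ≡ r ∸ 1
      ρXi≡r∸1 = trans (cong₂ (λ a d → a ⊓ r ∸ d) (∣X∣≡r i i<N) (memberDefect-X i i<N)) (cong (_∸ 1) (⊓-idem r))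
      ρ∁Xi≡r : ρ (∁ (X i)) ≡ r
      ρ∁Xi≡r = size-r⇒ρ≡r (∁ (X i)) (∣p∣≡r⇒∣∁p∣≡r (X i) (∣X∣≡r i i<N)) (∁X∉X i i<N)

    -- true when ∁ X i, rather than X i, has rank r - 1 in M
    lowered : ℕ → Bool
    lowered i = does (rank (X i) ℕ.≟ r)

    side : ∀ i → i < N → (lowered i ≡ true × rank (∁ (X i)) ≡ r ∸ 1) ⊎ (lowered i ≡ false × rank (X i) ≡ r ∸ 1)
    side i i<N = side′ (rank (X i) ℕ.≟ r)
      where
      side′ : (d : Dec (rank (X i) ≡ r)) →
              (does d ≡ true × rank (∁ (X i)) ≡ r ∸ 1) ⊎ (does d ≡ false × rank (X i) ≡ r ∸ 1)
      side′ (yes rankXi≡r) = inj₁ (refl , +-cancelˡ-≡ r _ _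
        (trans (cong (_+ rank (∁ (X i))) (sym rankXi≡r)) (trans (cycle-rank-sum i i<N) (+-comm (r ∸ 1) r))))
      side′ (no rankXi≢r) = inj₂ (refl , proj₁ (+-≡-componentwise (sym (cycle-rank-sum i i<N))
        (suc[m]≤n⇒m≤pred[n] (≤∧≢⇒< (rank≤r (X i)) rankXi≢r)) (rank≤r (∁ (X i)))))

    lowered-pair-far : ∀ A B → rank A ≡ r ∸ 1 → rank B ≡ r ∸ 1 → suc ∣ A ∩ B ∣ ≡ r → rank (A ∪ B) ≡ r → Empty
    lowered-pair-far A B rankA rankB near rankA∪B = <-irrefl refl (<-≤-trans r∸1<r r≤r∸1)
      where
      r∸1<r : r ∸ 1 < r
      r∸1<r = subst (_< r) (cong ℕ.pred near) (≤-reflexive near)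
      r≤r∸1 : r ≤ r ∸ 1
      r≤r∸1 = +-cancelˡ-≤ (r ∸ 1) r (r ∸ 1) (subst₂ _≤_
        (cong₂ _+_ (trans (proj₁ (near-rank (A ∩ B) near)) (cong ℕ.pred near)) rankA∪B) (cong₂ _+_ rankA rankB)
        (submod A B))

    near⇒sides-differ : ∀ i k → i < N → k < N → suc ∣ X i ∩ X k ∣ ≡ r → lowered i ≢ lowered k
    near⇒sides-differ i k i<N k<N near = differ (side i i<N) (side k k<N)
      where
      near∁ : suc ∣ ∁ (X i) ∩ ∁ (X k) ∣ ≡ r
      near∁ = trans (cong suc (∣∁p∩∁q∣≡∣p∩q∣ (X i) (X k) (∣X∣≡r i i<N) (∣X∣≡r k k<N))) near
      X∪≡∁∁∩∁ : X i ∪ X k ≡ ∁ (∁ (X i) ∩ ∁ (X k))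
      X∪≡∁∁∩∁ = sym (trans (∁-∩ (∁ (X i)) (∁ (X k))) (cong₂ _∪_ (∁-involutive (X i)) (∁-involutive (X k))))
      differ : (lowered i ≡ true × rank (∁ (X i)) ≡ r ∸ 1) ⊎ (lowered i ≡ false × rank (X i) ≡ r ∸ 1) →
               (lowered k ≡ true × rank (∁ (X k)) ≡ r ∸ 1) ⊎ (lowered k ≡ false × rank (X k) ≡ r ∸ 1) →
               lowered i ≢ lowered k
      differ (inj₁ (_ , rank∁Xi)) (inj₁ (_ , rank∁Xk)) _ =
        lowered-pair-far (∁ (X i)) (∁ (X k)) rank∁Xi rank∁Xk near∁
          (trans (cong rank (sym (∁-∩ (X i) (X k)))) (proj₂ (near-rank (X i ∩ X k) near)))
      differ (inj₂ (_ , rankXi)) (inj₂ (_ , rankXk)) _ =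
        lowered-pair-far (X i) (X k) rankXi rankXk near
          (trans (cong rank X∪≡∁∁∩∁) (proj₂ (near-rank (∁ (X i) ∩ ∁ (X k)) near∁)))
      differ (inj₁ (li , _)) (inj₂ (lk , _)) li≡lk with () ← trans (sym li) (trans li≡lk lk)
      differ (inj₂ (li , _)) (inj₁ (lk , _)) li≡lk with () ← trans (sym lk) (trans (sym li≡lk) li)

    lowered-alternates : ∀ i → suc i < N → lowered (suc i) ≡ not (lowered i)
    lowered-alternates i 1+i<N =
      ¬-not (≢-sym (near⇒sides-differ i (suc i) (<-trans (n<1+n i) 1+i<N) 1+i<N (consecutive-near i 1+i<N)))

    lowered-last≢lowered-first : lowered N′ ≢ lowered 0
    lowered-last≢lowered-first = near⇒sides-differ N′ 0 (n<1+n N′) z<s last-near-first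

    lowered-last≡lowered-first : lowered N′ ≡ lowered 0
    lowered-last≡lowered-first = trans (alternating⇒≡xor-odd lowered lowered-alternates N′ (n<1+n N′))
                                   (trans (cong (lowered 0 xor_) N′-even) (xor-identityʳ (lowered 0)))

  cycleConnectivity-not-matroidal : ¬ IsMatroidConnectivity cycleConnectivity
  cycleConnectivity-not-matroidal (M , f≡μM) =
    lowered-last≢lowered-first M f≡μM (lowered-last≡lowered-first M f≡μM)

  certificates-not-shorter-than-cycle : ∀ {B} → B < N →
    ¬ ((f : Subset n → ℚ) → IsConnectivityFunction f → ¬ IsMatroidConnectivity f →
       ∃ λ 𝒜 → length 𝒜 ≤ B × Certifies 𝒜 f)
  certificates-not-shorter-than-cycle {B} B<N certificates = refuted
    (certificates cycleConnectivity cycleConnectivity-isConnectivityFunction cycleConnectivity-not-matroidal)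
    where
    refuted : ¬ ∃ λ 𝒜 → length 𝒜 ≤ B × Certifies 𝒜 cycleConnectivity
    refuted (𝒜 , ∣𝒜∣≤B , certifies) = matroidalOn⇒¬certifies (cycleConnectivity-matroidalOn 𝒜 (≤-<-trans ∣𝒜∣≤B B<N)) certifies

-- Induced paths and cycles

module _ {A : Set} where
  EndsAt : List A → A → Set
  EndsAt []           a = Empty
  EndsAt (x ∷ [])     a = x ≡ a
  EndsAt (x ∷ y ∷ ys) a = EndsAt (y ∷ ys) a

  EndsAt-++ : ∀ xs ys a → EndsAt ys a → EndsAt (xs ++ ys) a
  EndsAt-++ []           ys       a end = end
  EndsAt-++ (x ∷ [])     (y ∷ ys) a end = end
  EndsAt-++ (x ∷ x′ ∷ xs) ys      a end = EndsAt-++ (x′ ∷ xs) ys a end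

  EndsAt-∷ : ∀ x ys a → EndsAt ys a → EndsAt (x ∷ ys) a
  EndsAt-∷ x (y ∷ ys) a end = end

  last-satisfies : ∀ {P : A → Set} y ys a → All P (y ∷ ys) → EndsAt (y ∷ ys) a → P a
  last-satisfies y []        a (py ∷ [])  refl = py
  last-satisfies y (y′ ∷ ys) a (_ ∷ pys) end  = last-satisfies y′ ys a pys end

EndsAt-map : ∀ {A B : Set} (f : A → B) → ∀ xs a → EndsAt xs a → EndsAt (map f xs) (f a)
EndsAt-map f (x ∷ [])     a refl = refl
EndsAt-map f (x ∷ y ∷ ys) a end  = EndsAt-map f (y ∷ ys) a end

module InducedPaths {S : Set} (d : S → S → ℕ) where

  Near : S → S → Set
  Near x y = d x y ≡ 1

  Far : S → S → Set
  Far x y = 2 ≤ d x y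

  InducedPath : List S → Set
  InducedPath []           = Unit
  InducedPath (x ∷ [])     = Unit
  InducedPath (x ∷ y ∷ ys) = Near x y × All (Far x) ys × InducedPath (y ∷ ys)

  head-apart : ∀ x xs → InducedPath (x ∷ xs) → All (λ y → 1 ≤ d x y) xs
  head-apart x []       _                = []
  head-apart x (y ∷ ys) (x~y , far-x , _) = ≤-reflexive (sym x~y) ∷ All.map (≤-trans (s≤s z≤n)) far-x

  InducedPath-tail : ∀ x xs → InducedPath (x ∷ xs) → InducedPath xs
  InducedPath-tail x []       _              = tt
  InducedPath-tail x (y ∷ ys) (_ , _ , path) = path

  LinksTo : List S → S → Set
  LinksTo []            y = Unit
  LinksTo (x ∷ [])      y = Near x y
  LinksTo (x ∷ x′ ∷ xs) y = Far x y × LinksTo (x′ ∷ xs) y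

  Joinable : List S → List S → Set
  Joinable xs []       = Unit
  Joinable xs (y ∷ ys) = All (λ x → All (Far x) ys) xs × LinksTo xs y

  InducedPath-++ : ∀ xs ys → InducedPath xs → InducedPath ys → Joinable xs ys → InducedPath (xs ++ ys)
  InducedPath-++ []            ys       _ path-ys _ = path-ys
  InducedPath-++ (x ∷ [])      []       _ _ _ = tt
  InducedPath-++ (x ∷ [])      (y ∷ ys) _ path-ys ((far-x ∷ []) , x~y) = x~y , far-x , path-ys
  InducedPath-++ (x ∷ x′ ∷ xs) []       path-xs _ _ rewrite ++-identityʳ xs = path-xs
  InducedPath-++ (x ∷ x′ ∷ xs) (y ∷ ys) (x~x′ , far-x , path-xs) path-ys ((far-x-ys ∷ far-xs-ys) , (far-x-y , links)) =
    x~x′ , ++⁺ far-x (far-x-y ∷ far-x-ys) , InducedPath-++ (x′ ∷ xs) (y ∷ ys) path-xs path-ys (far-xs-ys , links)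

  NearOnlyLast : S → List S → Set
  NearOnlyLast x []            = Empty
  NearOnlyLast x (w ∷ [])      = Near x w
  NearOnlyLast x (w ∷ w′ ∷ ws) = Far x w × NearOnlyLast x (w′ ∷ ws)

  NearOnlyLast-++ : ∀ x as bs → All (Far x) as → NearOnlyLast x bs → NearOnlyLast x (as ++ bs)
  NearOnlyLast-++ x []            bs       []            near = near
  NearOnlyLast-++ x (a ∷ [])      (b ∷ bs) (far ∷ [])    near = far , near
  NearOnlyLast-++ x (a ∷ a′ ∷ as) bs       (far ∷ fars)  near = far , NearOnlyLast-++ x (a′ ∷ as) bs fars near

  -- x ∷ ys is an induced cycle when ys is an induced path whose two ends are the only neighbours of x.
  Closes : S → List S → Set
  Closes x []       = Empty
  Closes x (y ∷ ys) = Near x y × NearOnlyLast x ys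

  nth : S → List S → ℕ → S
  nth default []       _       = default
  nth default (x ∷ xs) zero    = x
  nth default (x ∷ xs) (suc i) = nth default xs i

  private
    Far⇒≢0 : ∀ {x y} → Far x y → d x y ≢ 0
    Far⇒≢0 far e = <⇒≱ (s≤s z≤n) (subst (2 ≤_) e far)

    Far⇒≢1 : ∀ {x y} → Far x y → d x y ≢ 1
    Far⇒≢1 far e = <⇒≱ (s≤s (s≤s z≤n)) (subst (2 ≤_) e far)

    Near⇒≢0 : ∀ {x y} → Near x y → d x y ≢ 0
    Near⇒≢0 near e with () ← trans (sym e) near

    All-nth : ∀ {P : S → Set} default xs k → All P xs → k < length xs → P (nth default xs k)
    All-nth default (x ∷ xs) zero    (px ∷ _)   _         = px
    All-nth default (x ∷ xs) (suc k) (_ ∷ pxs) (s≤s k<n) = All-nth default xs k pxs k<n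

  path-distance : ∀ default xs i k → InducedPath xs → i < k → k < length xs →
    let dᵢₖ = d (nth default xs i) (nth default xs k) in dᵢₖ ≢ 0 × (dᵢₖ ≡ 1 → suc i ≡ k)
  path-distance default (x ∷ [])     zero    (suc k)       _ _ (s≤s ())
  path-distance default (x ∷ y ∷ ys) zero    (suc zero)    (x~y , _ , _) _ _ = Near⇒≢0 x~y , (λ _ → refl)
  path-distance default (x ∷ y ∷ ys) zero    (suc (suc k)) (_ , far-x , _) _ (s≤s (s≤s k<n)) =
    Far⇒≢0 far , (λ e → ⊥-elim (Far⇒≢1 far e))
    where far = All-nth default ys k far-x k<n
  path-distance default (x ∷ y ∷ ys) (suc i) (suc k)       (_ , _ , path) (s≤s i<k) (s≤s k<n)
    with path-distance default (y ∷ ys) i k path i<k k<n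
  ... | ≢0 , near⇒consecutive = ≢0 , cong suc ∘ near⇒consecutive

  path-near : ∀ default xs i → InducedPath xs → suc i < length xs → Near (nth default xs i) (nth default xs (suc i))
  path-near default (x ∷ [])     zero    _              (s≤s ())
  path-near default (x ∷ y ∷ ys) zero    (x~y , _ , _)  _         = x~y
  path-near default (x ∷ y ∷ ys) (suc i) (_ , _ , path) (s≤s i<n) = path-near default (y ∷ ys) i path i<n

  NearOnlyLast-distance : ∀ default x ws k → NearOnlyLast x ws → k < length ws →
    d x (nth default ws k) ≢ 0 × (d x (nth default ws k) ≡ 1 → suc k ≡ length ws)
  NearOnlyLast-distance default x (w ∷ [])      zero    near       _ = Near⇒≢0 near , (λ _ → refl)
  NearOnlyLast-distance default x (w ∷ [])      (suc k) _          (s≤s ())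
  NearOnlyLast-distance default x (w ∷ w′ ∷ ws) zero    (far , _)  _ = Far⇒≢0 far , (λ e → ⊥-elim (Far⇒≢1 far e))
  NearOnlyLast-distance default x (w ∷ w′ ∷ ws) (suc k) (_ , rest) (s≤s k<n)
    with NearOnlyLast-distance default x (w′ ∷ ws) k rest k<n
  ... | ≢0 , near⇒last = ≢0 , cong suc ∘ near⇒last

  NearOnlyLast-last : ∀ default x ws k → NearOnlyLast x ws → suc k ≡ length ws → Near x (nth default ws k)
  NearOnlyLast-last default x (w ∷ [])      zero    near       _ = near
  NearOnlyLast-last default x (w ∷ w′ ∷ ws) (suc k) (_ , rest) e = NearOnlyLast-last default x (w′ ∷ ws) k rest (suc-injective e)

  cycle-distance : ∀ x ys i k → InducedPath ys → Closes x ys → i < k → k < suc (length ys) →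
    let dᵢₖ = d (nth x (x ∷ ys) i) (nth x (x ∷ ys) k)
    in dᵢₖ ≢ 0 × (dᵢₖ ≡ 1 → suc i ≡ k ⊎ (i ≡ 0 × suc k ≡ suc (length ys)))
  cycle-distance x (y ∷ ys) zero (suc zero) _ (x~y , _) _ _ = Near⇒≢0 x~y , (λ _ → inj₁ refl)
  cycle-distance x (y ∷ ys) zero (suc (suc k)) _ (_ , near-last) _ (s≤s (s≤s k<n))
    with NearOnlyLast-distance x x ys k near-last k<n
  ... | ≢0 , near⇒last = ≢0 , (λ e → inj₂ (refl , cong (suc ∘ suc) (near⇒last e)))
  cycle-distance x ys (suc i) (suc k) path _ (s≤s i<k) (s≤s k<n) with path-distance x ys i k path i<k k<n
  ... | ≢0 , near⇒consecutive = ≢0 , (λ e → inj₁ (cong suc (near⇒consecutive e)))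

  cycle-near : ∀ x ys i → InducedPath ys → Closes x ys → suc i < suc (length ys) →
               Near (nth x (x ∷ ys) i) (nth x (x ∷ ys) (suc i))
  cycle-near x (y ∷ ys) zero    _    (x~y , _) _         = x~y
  cycle-near x ys       (suc i) path _         (s≤s i<n) = path-near x ys i path i<n

  cycle-closing : ∀ x ys → Closes x ys → Near x (nth x (x ∷ ys) (length ys))
  cycle-closing x (y ∷ w ∷ ws) (_ , near-last) = NearOnlyLast-last x x (w ∷ ws) (length ws) near-last refl

module DistancePreserving {S T : Set} {dS : S → S → ℕ} {dT : T → T → ℕ} where
  private
    module S = InducedPaths dS
    module T = InducedPaths dT

  module _ (f : S → T) (preserves : ∀ x y → dT (f x) (f y) ≡ dS x y) where

    Far-map : ∀ {x y} → S.Far x y → T.Far (f x) (f y)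
    Far-map {x} {y} = subst (2 ≤_) (sym (preserves x y))

    InducedPath-map : ∀ xs → S.InducedPath xs → T.InducedPath (map f xs)
    InducedPath-map []           _                     = tt
    InducedPath-map (x ∷ [])     _                     = tt
    InducedPath-map (x ∷ y ∷ ys) (x~y , far-x , path) =
      trans (preserves x y) x~y , map⁺ (All.map Far-map far-x) , InducedPath-map (y ∷ ys) path

  -- f and g embed S in two parallel layers of T at distance one.
  LinksTo-map : (f g : S → T) → (∀ x y → dT (f x) (g y) ≡ suc (dS x y)) → (∀ x → dS x x ≡ 0) →
                ∀ xs a → S.InducedPath xs → EndsAt xs a → T.LinksTo (map f xs) (g a)
  LinksTo-map f g shift dS-refl (x ∷ [])      a _    refl = trans (shift x x) (cong suc (dS-refl x))
  LinksTo-map f g shift dS-refl (x ∷ x′ ∷ xs) a path end  =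
    subst (2 ≤_) (sym (shift x a)) (s≤s (last-satisfies x′ xs a (S.head-apart x (x′ ∷ xs) path) end)) ,
    LinksTo-map f g shift dS-refl (x′ ∷ xs) a (S.InducedPath-tail x (x′ ∷ xs) path) end

-- An exponentially long odd induced cycle, encoded by sets of half size

data Peg : Set where
  p0 p1 p2 : Peg

dPeg : Peg → Peg → ℕ
dPeg p0 p0 = 0
dPeg p0 p1 = 1
dPeg p0 p2 = 2
dPeg p1 p0 = 1
dPeg p1 p1 = 0
dPeg p1 p2 = 1
dPeg p2 p0 = 2
dPeg p2 p1 = 1
dPeg p2 p2 = 0

flipPeg : Peg → Peg
flipPeg p0 = p2
flipPeg p1 = p1
flipPeg p2 = p0

dPeg-flip : ∀ p q → dPeg (flipPeg p) (flipPeg q) ≡ dPeg p q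
dPeg-flip p0 p0 = refl
dPeg-flip p0 p1 = refl
dPeg-flip p0 p2 = refl
dPeg-flip p1 p0 = refl
dPeg-flip p1 p1 = refl
dPeg-flip p1 p2 = refl
dPeg-flip p2 p0 = refl
dPeg-flip p2 p1 = refl
dPeg-flip p2 p2 = refl

dPeg-refl : ∀ p → dPeg p p ≡ 0
dPeg-refl p0 = refl
dPeg-refl p1 = refl
dPeg-refl p2 = refl

dPeg-sym : ∀ p q → dPeg p q ≡ dPeg q p
dPeg-sym p0 p0 = refl
dPeg-sym p0 p1 = refl
dPeg-sym p0 p2 = refl
dPeg-sym p1 p0 = refl
dPeg-sym p1 p1 = refl
dPeg-sym p1 p2 = refl
dPeg-sym p2 p0 = refl
dPeg-sym p2 p1 = refl
dPeg-sym p2 p2 = refl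

dGrid : ∀ {j} → Vec Peg j → Vec Peg j → ℕ
dGrid []      []      = 0
dGrid (p ∷ x) (q ∷ y) = dPeg p q + dGrid x y

dGrid-refl : ∀ {j} (x : Vec Peg j) → dGrid x x ≡ 0
dGrid-refl []      = refl
dGrid-refl (p ∷ x) = cong₂ _+_ (dPeg-refl p) (dGrid-refl x)

dGrid-sym : ∀ {j} (x y : Vec Peg j) → dGrid x y ≡ dGrid y x
dGrid-sym []      []      = refl
dGrid-sym (p ∷ x) (q ∷ y) = cong₂ _+_ (dPeg-sym p q) (dGrid-sym x y)

flipHead : ∀ {j} → Vec Peg (suc j) → Vec Peg (suc j)
flipHead (p ∷ x) = flipPeg p ∷ x

dGrid-flipHead : ∀ {j} (x y : Vec Peg (suc j)) → dGrid (flipHead x) (flipHead y) ≡ dGrid x y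
dGrid-flipHead (p ∷ x) (q ∷ y) = cong (_+ dGrid x y) (dPeg-flip p q)

origin : ∀ j → Vec Peg j
origin j = replicate j p0

snakeEnd : ∀ m → Vec Peg (suc m)
snakeEnd m = p2 ∷ origin m

-- Walk the first layer, step to the middle layer, walk back along the mirrored copy in the last layer.
snake : ∀ m → List (Vec Peg (suc m))
snake zero    = (p0 ∷ []) ∷ (p1 ∷ []) ∷ (p2 ∷ []) ∷ []
snake (suc m) = map (p0 ∷_) (snake m) ++ (p1 ∷ snakeEnd m) ∷ map (p2 ∷_) (map flipHead (snake m))

snake-head : ∀ m → ∃ λ rest → snake m ≡ origin (suc m) ∷ rest
snake-head zero = _ , refl
snake-head (suc m) with snake m | snake-head m
... | .(origin (suc m) ∷ rest) | rest , refl = _ , refl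

module Grid {j : ℕ} = InducedPaths (dGrid {j})
open DistancePreserving

snake-ends : ∀ m → EndsAt (snake m) (snakeEnd m)
snake-ends zero    = refl
snake-ends (suc m) = EndsAt-++ (map (p0 ∷_) (snake m)) _ (snakeEnd (suc m))
  (EndsAt-∷ _ (map (p2 ∷_) (map flipHead (snake m))) (snakeEnd (suc m))
    (EndsAt-map (p2 ∷_) (map flipHead (snake m)) (flipHead (snakeEnd m))
      (EndsAt-map flipHead (snake m) (snakeEnd m) (snake-ends m))))

snake-induced : ∀ m → Grid.InducedPath (snake m)
snake-induced zero = refl , (s≤s (s≤s z≤n) ∷ []) , refl , [] , tt
snake-induced (suc m) with snake m | snake-head m | snake-induced m | snake-ends m
... | .(origin (suc m) ∷ rest) | rest , refl | path | ends =
  Grid.InducedPath-++ (map (p0 ∷_) (origin (suc m) ∷ rest)) ((p1 ∷ snakeEnd m) ∷ map (p2 ∷_) (map flipHead (origin (suc m) ∷ rest)))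
    (InducedPath-map (p0 ∷_) (λ _ _ → refl) _ path)
    ( cong suc (dGrid-refl (origin m)) , middle-far
    , InducedPath-map (p2 ∷_) (λ _ _ → refl) _ (InducedPath-map flipHead dGrid-flipHead _ path))
    ( map⁺ (All.universal (λ _ → all-far-from-first-layer _) (origin (suc m) ∷ rest))
    , LinksTo-map (p0 ∷_) (p1 ∷_) (λ _ _ → refl) dGrid-refl (origin (suc m) ∷ rest) (snakeEnd m) path ends)
  where
  middle-far : All (Grid.Far (p1 ∷ snakeEnd m)) (map (p2 ∷_) (map flipHead rest))
  middle-far = map⁺ (map⁺ (All.map (λ {x} 1≤d → s≤s (subst (1 ≤_) (sym (dGrid-flipHead (origin (suc m)) x)) 1≤d))
                                   (Grid.head-apart (origin (suc m)) rest path)))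
  all-far-from-first-layer : ∀ x → All (Grid.Far (p0 ∷ x)) (map (p2 ∷_) (map flipHead (origin (suc m) ∷ rest)))
  all-far-from-first-layer x = map⁺ (All.universal (λ _ → s≤s (s≤s z≤n)) _)

snake-length : ∀ m → length (snake (suc m)) ≡ length (snake m) + suc (length (snake m))
snake-length m = trans (length-++ (map (p0 ∷_) (snake m)))
  (cong₂ _+_ (length-map (p0 ∷_) (snake m))
             (cong suc (trans (length-map (p2 ∷_) (map flipHead (snake m))) (length-map flipHead (snake m)))))

odd-double : ∀ k → odd (k + k) ≡ false
odd-double zero    = refl
odd-double (suc k) = trans (cong (not ∘ odd) (+-suc k k)) (trans (not-involutive (odd (k + k))) (odd-double k))

snake-odd : ∀ m → odd (length (snake m)) ≡ true
snake-odd zero    = refl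
snake-odd (suc m) = trans (cong odd (trans (snake-length m) (+-suc _ _))) (cong not (odd-double (length (snake m))))

snake-long : ∀ m → 2 ^ suc m ≤ length (snake m)
snake-long zero    = s≤s (s≤s z≤n)
snake-long (suc m) = begin
  2 ^ suc m + (2 ^ suc m + 0)            ≡⟨ cong (2 ^ suc m +_) (+-identityʳ (2 ^ suc m)) ⟩
  2 ^ suc m + 2 ^ suc m                  ≤⟨ +-mono-≤ (snake-long m) (m≤n⇒m≤1+n (snake-long m)) ⟩
  length (snake m) + suc (length (snake m)) ≡⟨ sym (snake-length m) ⟩
  length (snake (suc m))                 ∎
  where open ≤-Reasoning

snake-avoids-centre : ∀ m → All (λ x → 1 ≤ dGrid x (p1 ∷ origin (suc m))) (snake (suc m))
snake-avoids-centre m = ++⁺ (map⁺ (All.universal (λ _ → s≤s z≤n) (snake m)))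
                            (s≤s z≤n ∷ map⁺ (All.universal (λ _ → s≤s z≤n) (map flipHead (snake m))))

data Corner : Set where
  kA kB kC : Corner

dCorner : Corner → Corner → ℕ
dCorner kA kA = 0
dCorner kB kB = 0
dCorner kC kC = 0
dCorner kA kB = 1
dCorner kA kC = 1
dCorner kB kA = 1
dCorner kB kC = 1
dCorner kC kA = 1
dCorner kC kB = 1

dCorner-refl : ∀ k → dCorner k k ≡ 0
dCorner-refl kA = refl
dCorner-refl kB = refl
dCorner-refl kC = refl

dCorner-sym : ∀ k k′ → dCorner k k′ ≡ dCorner k′ k
dCorner-sym kA kA = refl
dCorner-sym kA kB = refl
dCorner-sym kA kC = refl
dCorner-sym kB kA = refl
dCorner-sym kB kB = refl
dCorner-sym kB kC = refl
dCorner-sym kC kA = refl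
dCorner-sym kC kB = refl
dCorner-sym kC kC = refl

Point : ℕ → Set
Point j = Corner × Vec Peg j

dPoint : ∀ {j} → Point j → Point j → ℕ
dPoint (k , x) (k′ , x′) = dCorner k k′ + dGrid x x′

dPoint-refl : ∀ {j} (s : Point j) → dPoint s s ≡ 0
dPoint-refl (k , x) = cong₂ _+_ (dCorner-refl k) (dGrid-refl x)

dPoint-sym : ∀ {j} (s t : Point j) → dPoint s t ≡ dPoint t s
dPoint-sym (k , x) (k′ , x′) = cong₂ _+_ (dCorner-sym k k′) (dGrid-sym x x′)

module Points {j : ℕ} = InducedPaths (dPoint {j})

module SnakeCycle (m : ℕ) where
  J : ℕ
  J = suc (suc m)

  centre : Vec Peg J
  centre = p1 ∷ origin (suc m)

  start : Point J
  start = kA , origin J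

  -- From (kA, end of the snake) back to the start through the other two corners of the triangle.
  detour : List (Point J)
  detour = (kB , snakeEnd (suc m)) ∷ (kB , centre) ∷ (kC , centre) ∷ (kC , origin J) ∷ []

  cycleTail : List (Vec Peg J) → List (Point J)
  cycleTail rest = map (kA ,_) rest ++ detour

  detour-induced : Points.InducedPath detour
  detour-induced = cong suc (dGrid-refl (origin (suc m))) , (s≤s (s≤s z≤n) ∷ s≤s (s≤s z≤n) ∷ [])
                 , cong suc (dGrid-refl (origin (suc m))) , (s≤s (s≤s z≤n) ∷ [])
                 , cong suc (dGrid-refl (origin (suc m))) , [] , tt

  detour-closes : Points.NearOnlyLast start detour
  detour-closes = s≤s (s≤s z≤n) , s≤s (s≤s z≤n) , s≤s (s≤s z≤n) , cong suc (dGrid-refl (origin (suc m)))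

  cycleTail-closes : ∀ rest → Grid.InducedPath (origin J ∷ rest) → EndsAt (origin J ∷ rest) (snakeEnd (suc m)) →
    All (λ x → 1 ≤ dGrid x centre) (origin J ∷ rest) → Points.InducedPath (cycleTail rest) × Points.Closes start (cycleTail rest)
  cycleTail-closes [] _ () _
  cycleTail-closes (y ∷ rest) path@(origin~y , far-origin , path′) ends (_ ∷ avoids-centre) =
    Points.InducedPath-++ (map (kA ,_) (y ∷ rest)) detour
      (InducedPath-map (kA ,_) (λ _ _ → refl) (y ∷ rest) path′) detour-induced
      ( map⁺ far-from-detour
      , LinksTo-map (kA ,_) (kB ,_) (λ _ _ → refl) dGrid-refl (y ∷ rest) (snakeEnd (suc m)) path′ ends)
    , origin~y , Points.NearOnlyLast-++ start (map (kA ,_) rest) detour (map⁺ far-origin) detour-closes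
    where
    far-from-detour : All (λ x → All (Points.Far (kA , x)) ((kB , centre) ∷ (kC , centre) ∷ (kC , origin J) ∷ [])) (y ∷ rest)
    far-from-detour = All.map (λ {x} (avoids , apart) → s≤s avoids ∷ s≤s avoids ∷ s≤s (subst (1 ≤_) (dGrid-sym (origin J) x) apart) ∷ [])
                              (All.zip (avoids-centre , Grid.head-apart (origin J) (y ∷ rest) path))

encodeCorner : Corner → Subset 6
encodeCorner kA = true ∷ true ∷ true  ∷ false ∷ false ∷ false ∷ []
encodeCorner kB = true ∷ true ∷ false ∷ true  ∷ false ∷ false ∷ []
encodeCorner kC = true ∷ true ∷ false ∷ false ∷ true  ∷ false ∷ []

encodePeg : Peg → Subset 4
encodePeg p0 = true  ∷ true  ∷ false ∷ false ∷ []
encodePeg p1 = false ∷ true  ∷ true  ∷ false ∷ []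
encodePeg p2 = false ∷ false ∷ true  ∷ true  ∷ []

encodeGrid : ∀ {j} → Vec Peg j → Subset (j * 4)
encodeGrid []      = []
encodeGrid (p ∷ x) = encodePeg p ++ᵛ encodeGrid x

encode : ∀ {j} → Point j → Subset (6 + j * 4)
encode (k , x) = encodeCorner k ++ᵛ encodeGrid x

encodeCorner-overlap : ∀ k k′ → ∣ encodeCorner k ∩ encodeCorner k′ ∣ + dCorner k k′ ≡ 3
encodeCorner-overlap kA kA = refl
encodeCorner-overlap kA kB = refl
encodeCorner-overlap kA kC = refl
encodeCorner-overlap kB kA = refl
encodeCorner-overlap kB kB = refl
encodeCorner-overlap kB kC = refl
encodeCorner-overlap kC kA = refl
encodeCorner-overlap kC kB = refl
encodeCorner-overlap kC kC = refl

2≤∣encodeCorner∩encodeCorner∣ : ∀ k k′ → 2 ≤ ∣ encodeCorner k ∩ encodeCorner k′ ∣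
2≤∣encodeCorner∩encodeCorner∣ k k′ = +-cancelʳ-≤ (dCorner k k′) 2 _
  (subst (2 + dCorner k k′ ≤_) (sym (encodeCorner-overlap k k′)) (dCorner≤1 k k′))
  where
  dCorner≤1 : ∀ k k′ → 2 + dCorner k k′ ≤ 3
  dCorner≤1 kA kA = s≤s (s≤s z≤n)
  dCorner≤1 kA kB = ≤-refl
  dCorner≤1 kA kC = ≤-refl
  dCorner≤1 kB kA = ≤-refl
  dCorner≤1 kB kB = s≤s (s≤s z≤n)
  dCorner≤1 kB kC = ≤-refl
  dCorner≤1 kC kA = ≤-refl
  dCorner≤1 kC kB = ≤-refl
  dCorner≤1 kC kC = s≤s (s≤s z≤n)

encodePeg-overlap : ∀ p q → ∣ encodePeg p ∩ encodePeg q ∣ + dPeg p q ≡ 2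
encodePeg-overlap p0 p0 = refl
encodePeg-overlap p0 p1 = refl
encodePeg-overlap p0 p2 = refl
encodePeg-overlap p1 p0 = refl
encodePeg-overlap p1 p1 = refl
encodePeg-overlap p1 p2 = refl
encodePeg-overlap p2 p0 = refl
encodePeg-overlap p2 p1 = refl
encodePeg-overlap p2 p2 = refl

encodeGrid-overlap : ∀ {j} (x y : Vec Peg j) → ∣ encodeGrid x ∩ encodeGrid y ∣ + dGrid x y ≡ j * 2
encodeGrid-overlap []      []      = refl
encodeGrid-overlap {suc j} (p ∷ x) (q ∷ y) = begin
  ∣ encodeGrid (p ∷ x) ∩ encodeGrid (q ∷ y) ∣ + (dPeg p q + dGrid x y)
    ≡⟨ cong (_+ (dPeg p q + dGrid x y)) (∣∩-++∣ (encodePeg p) (encodePeg q) (encodeGrid x) (encodeGrid y)) ⟩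
  ∣ encodePeg p ∩ encodePeg q ∣ + ∣ encodeGrid x ∩ encodeGrid y ∣ + (dPeg p q + dGrid x y)
    ≡⟨ interchange ∣ encodePeg p ∩ encodePeg q ∣ _ (dPeg p q) _ ⟩
  (∣ encodePeg p ∩ encodePeg q ∣ + dPeg p q) + (∣ encodeGrid x ∩ encodeGrid y ∣ + dGrid x y)
    ≡⟨ cong₂ _+_ (encodePeg-overlap p q) (encodeGrid-overlap x y) ⟩
  2 + j * 2 ∎
  where open ≡-Reasoning

encode-overlap : ∀ {j} (s t : Point j) → ∣ encode s ∩ encode t ∣ + dPoint s t ≡ 3 + j * 2
encode-overlap {j} (k , x) (k′ , y) = begin
  ∣ encode (k , x) ∩ encode (k′ , y) ∣ + (dCorner k k′ + dGrid x y)
    ≡⟨ cong (_+ (dCorner k k′ + dGrid x y)) (∣∩-++∣ (encodeCorner k) (encodeCorner k′) (encodeGrid x) (encodeGrid y)) ⟩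
  ∣ encodeCorner k ∩ encodeCorner k′ ∣ + ∣ encodeGrid x ∩ encodeGrid y ∣ + (dCorner k k′ + dGrid x y)
    ≡⟨ interchange ∣ encodeCorner k ∩ encodeCorner k′ ∣ _ (dCorner k k′) _ ⟩
  (∣ encodeCorner k ∩ encodeCorner k′ ∣ + dCorner k k′) + (∣ encodeGrid x ∩ encodeGrid y ∣ + dGrid x y)
    ≡⟨ cong₂ _+_ (encodeCorner-overlap k k′) (encodeGrid-overlap x y) ⟩
  3 + j * 2 ∎
  where open ≡-Reasoning

double-half : ∀ j → 6 + j * 4 ≡ (3 + j * 2) + (3 + j * 2)
double-half = solve-∀

∣p∣≡overlap-with-self : ∀ {n} (p : Subset n) → ∣ p ∣ ≡ ∣ p ∩ p ∣ + 0
∣p∣≡overlap-with-self p = trans (cong ∣_∣ (sym (∩-idem p))) (sym (+-identityʳ _))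

∣encodeGrid∣ : ∀ {j} (x : Vec Peg j) → ∣ encodeGrid x ∣ ≡ j * 2
∣encodeGrid∣ x = trans (∣p∣≡overlap-with-self (encodeGrid x)) (trans (cong (∣ encodeGrid x ∩ encodeGrid x ∣ +_) (sym (dGrid-refl x))) (encodeGrid-overlap x x))

∣encode∣ : ∀ {j} (s : Point j) → ∣ encode s ∣ ≡ 3 + j * 2
∣encode∣ s = trans (∣p∣≡overlap-with-self (encode s)) (trans (cong (∣ encode s ∩ encode s ∣ +_) (sym (dPoint-refl s))) (encode-overlap s s))

2≤∣encode∩encode∣ : ∀ {j} (s t : Point j) → 2 ≤ ∣ encode s ∩ encode t ∣
2≤∣encode∩encode∣ (k , x) (k′ , y) = subst (2 ≤_)
  (sym (∣∩-++∣ (encodeCorner k) (encodeCorner k′) (encodeGrid x) (encodeGrid y)))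
  (≤-trans (2≤∣encodeCorner∩encodeCorner∣ k k′) (m≤m+n _ _))

outsiderCorner : Subset 6
outsiderCorner = true ∷ true ∷ false ∷ false ∷ false ∷ true ∷ []

outsiderCorner≢ : ∀ k → outsiderCorner ≢ encodeCorner k
outsiderCorner≢ kA ()
outsiderCorner≢ kB ()
outsiderCorner≢ kC ()

outsiderCorner≢∁ : ∀ k → outsiderCorner ≢ ∁ (encodeCorner k)
outsiderCorner≢∁ kA ()
outsiderCorner≢∁ kB ()
outsiderCorner≢∁ kC ()

outsider≢encode : ∀ {j} (y : Vec Peg j) (s : Point j) → outsiderCorner ++ᵛ encodeGrid y ≢ encode s
outsider≢encode y (k , x) e = outsiderCorner≢ k (++-injectiveˡ outsiderCorner (encodeCorner k) e)

outsider≢∁encode : ∀ {j} (y : Vec Peg j) (s : Point j) → outsiderCorner ++ᵛ encodeGrid y ≢ ∁ (encode s)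
outsider≢∁encode y (k , x) e =
  outsiderCorner≢∁ k (++-injectiveˡ outsiderCorner (∁ (encodeCorner k)) (trans e (∁-++ (encodeCorner k) (encodeGrid x))))

module SnakeCycleOfHalves (m : ℕ) where
  open SnakeCycle m

  abstract
    snakeTail : List (Vec Peg J)
    snakeTail = proj₁ (snake-head (suc m))

    snake≡ : snake (suc m) ≡ origin J ∷ snakeTail
    snake≡ = proj₂ (snake-head (suc m))

  points : List (Point J)
  points = cycleTail snakeTail

  closed : Points.InducedPath points × Points.Closes start points
  closed = cycleTail-closes snakeTail
    (subst Grid.InducedPath snake≡ (snake-induced (suc m)))
    (subst (λ xs → EndsAt xs (snakeEnd (suc m))) snake≡ (snake-ends (suc m)))
    (subst (All (λ x → 1 ≤ dGrid x centre)) snake≡ (snake-avoids-centre m))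

  N′ : ℕ
  N′ = length points

  r : ℕ
  r = 3 + J * 2

  point : ℕ → Point J
  point = Points.nth start (start ∷ points)

  X : ℕ → Subset (6 + J * 4)
  X i = encode (point i)

  dist : ℕ → ℕ → ℕ
  dist i k = dPoint (point i) (point k)

  pointOverlap : ∀ i k → ∣ X i ∩ X k ∣ + dist i k ≡ r
  pointOverlap i k = encode-overlap (point i) (point k)

  distance : ∀ i k → i < k → k < suc N′ →
             dist i k ≢ 0 × (dist i k ≡ 1 → suc i ≡ k ⊎ (i ≡ 0 × suc k ≡ suc N′))
  distance i k = Points.cycle-distance start points i k (proj₁ closed) (proj₂ closed)

  full-overlap⇒dist≡0 : ∀ i k → ∣ X i ∩ X k ∣ ≡ r → dist i k ≡ 0
  full-overlap⇒dist≡0 i k full = +-cancelˡ-≡ r _ _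
    (trans (subst (λ o → o + dist i k ≡ r) full (pointOverlap i k)) (sym (+-identityʳ r)))

  near-overlap⇒dist≡1 : ∀ i k → suc ∣ X i ∩ X k ∣ ≡ r → dist i k ≡ 1
  near-overlap⇒dist≡1 i k near = +-cancelˡ-≡ ∣ X i ∩ X k ∣ _ _ (trans (pointOverlap i k) (trans (sym near) (+-comm 1 _)))

  ∣X∩X∣≡r⇒≡ : ∀ i k → i < suc N′ → k < suc N′ → ∣ X i ∩ X k ∣ ≡ r → i ≡ k
  ∣X∩X∣≡r⇒≡ i k i<N k<N full with <-cmp i k
  ... | tri< i<k _ _ = ⊥-elim (proj₁ (distance i k i<k k<N) (full-overlap⇒dist≡0 i k full))
  ... | tri≈ _ i≡k _ = i≡k
  ... | tri> _ _ k<i = ⊥-elim (proj₁ (distance k i k<i i<N)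
                         (trans (dPoint-sym (point k) (point i)) (full-overlap⇒dist≡0 i k full)))

  1+∣X∩X∣≡r⇒adjacent : ∀ i k → i < suc N′ → k < suc N′ → suc ∣ X i ∩ X k ∣ ≡ r → Adjacent (suc N′) i k
  1+∣X∩X∣≡r⇒adjacent i k i<N k<N near with <-cmp i k
  ... | tri< i<k _ _ with proj₂ (distance i k i<k k<N) (near-overlap⇒dist≡1 i k near)
  ...   | inj₁ consecutive = inj₁ consecutive
  ...   | inj₂ wrap        = inj₂ (inj₂ (inj₁ wrap))
  1+∣X∩X∣≡r⇒adjacent i k i<N k<N near | tri≈ _ refl _
    with () ← trans (sym (dPoint-refl (point i))) (near-overlap⇒dist≡1 i i near)
  1+∣X∩X∣≡r⇒adjacent i k i<N k<N near | tri> _ _ k<i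
    with proj₂ (distance k i k<i i<N) (trans (dPoint-sym (point k) (point i)) (near-overlap⇒dist≡1 i k near))
  ...   | inj₁ consecutive = inj₂ (inj₁ consecutive)
  ...   | inj₂ wrap        = inj₂ (inj₂ (inj₂ wrap))

  near⇒1+∣X∩X∣≡r : ∀ i k → dist i k ≡ 1 → suc ∣ X i ∩ X k ∣ ≡ r
  near⇒1+∣X∩X∣≡r i k near = trans (+-comm 1 _) (trans (cong (∣ X i ∩ X k ∣ +_) (sym near)) (pointOverlap i k))

  length-points : N′ ≡ length snakeTail + 4
  length-points = trans (length-++ (map (λ (x : Vec Peg J) → kA , x) snakeTail) {ys = detour})
                        (cong (_+ 4) (length-map (λ (x : Vec Peg J) → kA , x) snakeTail))

  length-snake : length (snake (suc m)) ≡ suc (length snakeTail)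
  length-snake = cong length snake≡

  N′-even : odd N′ ≡ false
  N′-even = trans (cong odd (trans length-points (+-comm (length snakeTail) 4)))
    (trans (not-involutive (not (not (odd (length snakeTail)))))
      (trans (not-involutive (odd (length snakeTail)))
        (not-injective (trans (cong odd (sym length-snake)) (snake-odd (suc m))))))

  outsider : Subset (6 + J * 4)
  outsider = outsiderCorner ++ᵛ encodeGrid (origin J)

  oddCycle : OddCycleOfHalves (6 + J * 4)
  oddCycle = record
    { r                  = r
    ; n≡r+r              = double-half J
    ; N′                 = N′
    ; X                  = X
    ; ∣X∣≡r              = λ i _ → ∣encode∣ (point i)
    ; 2≤∣X∩X∣            = λ i k _ _ → 2≤∣encode∩encode∣ (point i) (point k)
    ; ∣X∩X∣≡r⇒≡          = ∣X∩X∣≡r⇒≡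
    ; 1+∣X∩X∣≡r⇒adjacent = 1+∣X∩X∣≡r⇒adjacent
    ; consecutive-near   = λ i 1+i<N → near⇒1+∣X∩X∣≡r i (suc i)
                             (Points.cycle-near start points i (proj₁ closed) (proj₂ closed) 1+i<N)
    ; last-near-first    = near⇒1+∣X∩X∣≡r N′ 0 (trans (dPoint-sym (point N′) (point 0))
                             (Points.cycle-closing start points (proj₂ closed)))
    ; N′-even            = N′-even
    ; 4≤N′               = subst (4 ≤_) (sym length-points) (m≤n+m 4 (length snakeTail))
    ; Y₀                 = outsider
    ; ∣Y₀∣≡r             = trans (∣p++q∣≡∣p∣+∣q∣ outsiderCorner (encodeGrid (origin J))) (cong (3 +_) (∣encodeGrid∣ (origin J)))
    ; Y₀≢X               = λ i _ → outsider≢encode (origin J) (point i)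
    ; Y₀≢∁X              = λ i _ → outsider≢∁encode (origin J) (point i)
    }

  2^J≤N : 2 ^ J ≤ suc N′
  2^J≤N = ≤-trans (snake-long (suc m)) (≤-trans (≤-reflexive length-snake)
            (s≤s (subst (length snakeTail ≤_) (sym length-points) (m≤m+n _ 4))))

-- Polynomial against exponential growth

sumCoefficients : Poly → ℕ
sumCoefficients []       = 0
sumCoefficients (c ∷ cs) = c + sumCoefficients cs

eval≤sum*[1+x]^length : ∀ p x → eval p x ≤ sumCoefficients p * suc x ^ length p
eval≤sum*[1+x]^length []       x = z≤n
eval≤sum*[1+x]^length (c ∷ cs) x = begin
  c + x * eval cs x         ≤⟨ +-mono-≤ (subst (_≤ c * P) (*-identityʳ c) (*-monoʳ-≤ c (m^n>0 (suc x) (suc (length cs)))))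
                                        (*-mono-≤ (n≤1+n x) (eval≤sum*[1+x]^length cs x)) ⟩
  c * P + suc x * (S′ * Y)  ≡⟨ cong (c * P +_) (swap-factors (suc x) S′ Y) ⟩
  c * P + S′ * P            ≡⟨ sym (*-distribʳ-+ P c S′) ⟩
  (c + S′) * P              ∎
  where
  open ≤-Reasoning
  S′ = sumCoefficients cs
  Y  = suc x ^ length cs
  P  = suc x * Y
  swap-factors : ∀ a b y → a * (b * y) ≡ b * (a * y)
  swap-factors = solve-∀

n<2^n : ∀ n → n < 2 ^ n
n<2^n zero    = s≤s z≤n
n<2^n (suc n) = begin-strict
  suc n            <⟨ s≤s ≤-refl ⟩
  1 + suc n        ≤⟨ +-mono-≤ (m^n>0 2 n) (n<2^n n) ⟩
  2 ^ n + 2 ^ n    ≡⟨ cong (2 ^ n +_) (sym (+-identityʳ (2 ^ n))) ⟩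
  2 ^ suc n        ∎
  where open ≤-Reasoning

-- With t = S + 3d + 3: S + (2t + 3) d ≤ t * t ≤ 2 ^ (2t).
linear≤2^double : ∀ S d → let t = S + 3 * d + 3 in S + (t + t + 3) * d ≤ 2 ^ (t + t)
linear≤2^double S d = begin
  S + (t + t + 3) * d                    ≡⟨ cong (S +_) (expand₁ t d) ⟩
  S + (t * d + t * d + 3 * d)            ≤⟨ +-mono-≤ S≤t*S (+-monoʳ-≤ (t * d + t * d) 3d≤t*d) ⟩
  t * S + (t * d + t * d + t * d)        ≡⟨ cong (t * S +_) (sym (expand₂ t d)) ⟩
  t * S + t * (3 * d)                    ≤⟨ m≤m+n _ _ ⟩
  t * S + t * (3 * d) + t * 3            ≡⟨ sym (expand₃ S d) ⟩
  t * t                                  ≤⟨ *-mono-≤ (<⇒≤ (n<2^n t)) (<⇒≤ (n<2^n t)) ⟩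
  2 ^ t * 2 ^ t                          ≡⟨ sym (^-distribˡ-+-* 2 t t) ⟩
  2 ^ (t + t)                            ∎
  where
  open ≤-Reasoning
  t = S + 3 * d + 3
  S≤t*S : S ≤ t * S
  S≤t*S = subst (_≤ t * S) (*-identityˡ S) (*-monoˡ-≤ S (subst (1 ≤_) (+-comm 3 (S + 3 * d)) (s≤s z≤n)))
  3d≤t*d : 3 * d ≤ t * d
  3d≤t*d = *-monoˡ-≤ d (m≤n+m 3 (S + 3 * d))
  expand₁ : ∀ t d → (t + t + 3) * d ≡ t * d + t * d + 3 * d
  expand₁ = solve-∀
  expand₂ : ∀ t d → t * (3 * d) ≡ t * d + t * d + t * d
  expand₂ = solve-∀
  expand₃ : ∀ S d → (S + 3 * d + 3) * (S + 3 * d + 3) ≡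
                    (S + 3 * d + 3) * S + (S + 3 * d + 3) * (3 * d) + (S + 3 * d + 3) * 3
  expand₃ = solve-∀

eval<2^J : ∀ p → ∃ λ m → eval p (6 + suc (suc m) * 4) < 2 ^ suc (suc m)
eval<2^J p = J ∸ 2 , subst (λ J → eval p (6 + J * 4) < 2 ^ J) (sym 2+[J∸2]≡J) eval<2^J′
  where
  S = sumCoefficients p
  d = length p
  k = (S + 3 * d + 3) + (S + 3 * d + 3)
  J = 2 ^ k
  2≤J : 2 ≤ J
  2≤J = ^-monoʳ-≤ 2 {1} {k} (≤-trans (subst (1 ≤_) (+-comm 3 (S + 3 * d)) (s≤s z≤n)) (m≤m+n _ _))
  2+[J∸2]≡J : suc (suc (J ∸ 2)) ≡ J
  2+[J∸2]≡J = trans (+-comm 2 (J ∸ 2)) (m∸n+n≡m 2≤J)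
  1+n≤2^[k+3] : suc (6 + J * 4) ≤ 2 ^ (k + 3)
  1+n≤2^[k+3] = begin
    7 + J * 4        ≤⟨ +-monoˡ-≤ (J * 4) (≤-trans (n≤1+n 7) (*-monoˡ-≤ 4 2≤J)) ⟩
    J * 4 + J * 4    ≡⟨ sym (*-distribˡ-+ J 4 4) ⟩
    J * 8            ≡⟨ sym (^-distribˡ-+-* 2 k 3) ⟩
    2 ^ (k + 3)      ∎
    where open ≤-Reasoning
  eval<2^J′ : eval p (6 + J * 4) < 2 ^ J
  eval<2^J′ = begin-strict
    eval p (6 + J * 4)                   ≤⟨ eval≤sum*[1+x]^length p (6 + J * 4) ⟩
    S * suc (6 + J * 4) ^ d              ≤⟨ *-monoʳ-≤ S (^-monoˡ-≤ d 1+n≤2^[k+3]) ⟩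
    S * (2 ^ (k + 3)) ^ d                ≡⟨ cong (S *_) (^-*-assoc 2 (k + 3) d) ⟩
    S * 2 ^ ((k + 3) * d)                <⟨ *-monoˡ-< (2 ^ ((k + 3) * d)) {{m^n≢0 2 ((k + 3) * d)}} (n<2^n S) ⟩
    2 ^ S * 2 ^ ((k + 3) * d)            ≡⟨ sym (^-distribˡ-+-* 2 S ((k + 3) * d)) ⟩
    2 ^ (S + (k + 3) * d)                ≤⟨ ^-monoʳ-≤ 2 (linear≤2^double S d) ⟩
    2 ^ J                                ∎
    where open ≤-Reasoning

mainTheorem12 : (p : Poly) →
    ¬ ((n : ℕ) (f : Subset n → ℚ) → IsConnectivityFunction f → ¬ IsMatroidConnectivity f →
       Σ (List (Subset n)) (λ 𝒜 → (length 𝒜 ≤ eval p n) ×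
         ((g : Subset n → ℚ) → IsConnectivityFunction g → All (λ X → g X ≡ f X) 𝒜 →
           ¬ IsMatroidConnectivity g)))
mainTheorem12 p short-certificates =
  let (m , eval<2^[m+2]) = eval<2^J p
  in OddCycle.certificates-not-shorter-than-cycle (SnakeCycleOfHalves.oddCycle m)
       (<-≤-trans eval<2^[m+2] (SnakeCycleOfHalves.2^J≤N m)) (short-certificates _)
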